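{- Let $1\le m\le n$ and $0\le k\le n-1$ be integers. The map $\Xi_{m,n;k}$ defined in the context is a bijection from $B(m,n;k)$ onto $PF(m,n)$.
   Context: Parking lot: the directed path $I$ with vertices $1,2,\dots,n$. A preference tuple $(a_1,\dots,a_m)\in[n]^m$ describes cars $c_1,\dots,c_m$ arriving in order. Classical parking: car $c_j$ parks at $a_j$ if free; otherwise it drives forward and parks at the first free vertex after $a_j$; if none exists the process fails. $PF(m,n)$ is the set of tuples for which all $m$ cars park. $k$-Naples parking: car $c_j$ parks at $a_j$ if free. Otherwise, if some vertex of $\{a_j-1,a_j-2,\dots,a_j-k\}\cap[n]$ is free, it parks at the free one closest to $a_j$; if all of these are occupied, it drives forward and parks at the first free vertex after $a_j$ (failing if none exists). $PF(m,n;k)$ is the set of tuples for which all cars park. The set $B(m,n;k)\subseteq PF(m,n;k)$ of contained $k$-Naples parking functions consists of those tuples such that whenever $a_i\le k$, some vertex of $\{1,\dots,a_i\}$ is not occupied by any of $c_1,\dots,c_{i-1}$. Concatenation of tuples is denoted $\oplus$; $\mathrm{len}$ is the number of entries. Parking reflection $\Phi_{\ell,n}$ on $PF(\ell,n)$: for $g\in PF(\ell,n)$, the traverse path of a car is the set of vertices from its preference to the vertex where it parks. Two vertices are related if they are connected by a chain of traverse paths each overlapping the next; the resulting classes (intervals of vertices) are the parking components. If $L=\{i,i+1,\dots,i+j\}$ is a parking component and a car prefers $i+a$ ($0\le a\le j$), then in $\Phi_{\ell,n}(g)$ this car prefers $n-i-j+a+1$ (the component is moved to its mirror-image position $\{n-i-j+1,\dots,n-i+1\}$,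 with order within it preserved). All cars have preferences in some parking component, so this defines $\Phi_{\ell,n}(g)\in PF(\ell,n)$. $k$-decomposition: for $f\in PF(m,n;k)$, call a car backward-type if it parks at or before its preferred vertex, and forward-type if it parks after it. Write $f=f_1\oplus f_2\oplus\cdots\oplus f_d$ where the $f_i$ are the maximal consecutive blocks of cars of the same type; $f_i$ consists of backward-type cars for $i$ odd and of forward-type cars for $i$ even. Definition of $\Xi_{m,n;k}(f)$ for $f\in B(m,n;k)$ with $k$-decomposition $f_1\oplus\cdots\oplus f_d$: let $\nu_1$ be obtained from $f_1$ by replacing each entry $p$ by $n+1-p$, and set $\Xi_1=\nu_1$. For $2\le i\le d$, let $\nu_i$ be obtained from $f_i$ by replacing each entry $p$ by $n+1-p$ if $i$ is odd, and by $p-k$ if $i$ is even, and set $\Xi_i=\Phi_{\ell_i,n}(\Xi_{i-1})\oplus\nu_i$, where $\ell_i=\sum_{u=1}^{i-1}\mathrm{len}(f_u)$. Finally $\Xi_{m,n;k}(f)=\Xi_d$. -}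

module Defs where

open import Data.Nat using (ℕ; zero; suc; _+_; _∸_; _≤_; _<_; _⊓_; _⊔_; _≡ᵇ_; _≤ᵇ_)
open import Data.Bool using (Bool; true; false; if_then_else_; not; _∧_)
open import Data.List using (List; []; _∷_; _++_; map; upTo; zip; zipWith; foldl; length; filterᵇ)
open import Data.Bool.ListAction using (any)
open import Data.Maybe using (Maybe; just; nothing; _>>=_) renaming (map to mapMaybe)
open import Data.Product using (_×_; _,_; ∃)
open import Data.List.Relation.Unary.All using (All)
open import Data.List.Membership.Propositional using (_∉_)
open import Relation.Binary.PropositionalEquality using (_≡_)

-- Vertices of the lot are 1..n (natural numbers).  A preference tuple is
-- a list of naturals; the parking process also rejects out-of-range
-- preferences.

-- [a, a+1, ..., b]  (empty if b < a)
range : ℕ → ℕ → List ℕ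
range a b = map (a +_) (upTo (suc b ∸ a))

memb : ℕ → List ℕ → Bool
memb v occ = any (λ x → x ≡ᵇ v) occ

firstFree : List ℕ → List ℕ → Maybe ℕ
firstFree occ [] = nothing
firstFree occ (v ∷ vs) = if memb v occ then firstFree occ vs else just v

inLot : ℕ → ℕ → Bool
inLot n a = (1 ≤ᵇ a) ∧ (a ≤ᵇ n)

classicalStep : ℕ → List ℕ → ℕ → Maybe ℕ
classicalStep n occ a =
  if not (inLot n a) then nothing
  else (if not (memb a occ) then just a else firstFree occ (range (suc a) n))

backCands : ℕ → ℕ → List ℕ
backCands k a = filterᵇ (λ v → 1 ≤ᵇ v) (map (a ∸_) (range 1 k))

backOrForward : ℕ → List ℕ → ℕ → Maybe ℕ → Maybe ℕ
backOrForward n occ a (just v) = just v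
backOrForward n occ a nothing = firstFree occ (range (suc a) n)

naplesStep : ℕ → ℕ → List ℕ → ℕ → Maybe ℕ
naplesStep k n occ a =
  if not (inLot n a) then nothing
  else (if not (memb a occ) then just a
        else backOrForward n occ a (firstFree occ (backCands k a)))

run : (List ℕ → ℕ → Maybe ℕ) → List ℕ → List ℕ → Maybe (List ℕ)
run step occ [] = just []
run step occ (a ∷ as) with step occ a
... | nothing = nothing
... | just v = mapMaybe (v ∷_) (run step (v ∷ occ) as)

parkC : ℕ → List ℕ → Maybe (List ℕ)
parkC n f = run (classicalStep n) [] f

parkK : ℕ → ℕ → List ℕ → Maybe (List ℕ)
parkK k n f = run (naplesStep k n) [] f

InLot : ℕ → List ℕ → Set
InLot n f = All (λ a → 1 ≤ a × a ≤ n) f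

PF : ℕ → ℕ → List ℕ → Set
PF m n f = length f ≡ m × InLot n f × ∃ λ s → parkC n f ≡ just s

PFk : ℕ → ℕ → ℕ → List ℕ → Set
PFk m n k f = length f ≡ m × InLot n f × ∃ λ s → parkK k n f ≡ just s

B : ℕ → ℕ → ℕ → List ℕ → Set
B m n k f = PFk m n k f ×
  (∀ g a h → f ≡ g ++ (a ∷ h) → a ≤ k → ∀ occ → parkK k n g ≡ just occ →
     ∃ λ v → 1 ≤ v × v ≤ a × v ∉ occ)

-- traverse paths: (preference , parking spot) of each car
-- one pass: enlarge interval [lo,hi] by all traverse paths meeting it
grow : List (ℕ × ℕ) → ℕ × ℕ → ℕ × ℕ
grow ps (lo , hi) = foldl step (lo , hi) ps
  where
  step : ℕ × ℕ → ℕ × ℕ → ℕ × ℕ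
  step (l , h) (p , s) = if (p ≤ᵇ hi) ∧ (lo ≤ᵇ s) then (l ⊓ p , h ⊔ s) else (l , h)

iter : ℕ → (ℕ × ℕ → ℕ × ℕ) → ℕ × ℕ → ℕ × ℕ
iter zero g x = x
iter (suc i) g x = iter i g (g x)

-- parking component (as [lo , hi]) containing vertex v: closure of {v}
-- under chains of overlapping traverse paths (stabilises after
-- length ps + 1 passes)
component : List (ℕ × ℕ) → ℕ → ℕ × ℕ
component ps v = iter (suc (length ps)) (grow ps) (v , v)

reflectPref : ℕ → List (ℕ × ℕ) → ℕ → ℕ
reflectPref n ps p with component ps p
... | (lo , hi) = (suc n ∸ hi) + (p ∸ lo)

Φ : ℕ → List ℕ → Maybe (List ℕ)
Φ n g = mapMaybe (λ s → map (reflectPref n (zip g s)) g) (parkC n g)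

-- each car tagged with true = backward-type (parks at or before its
-- preference), false = forward-type
typed : ℕ → ℕ → List ℕ → Maybe (List (ℕ × Bool))
typed k n f = mapMaybe (λ s → zipWith (λ a v → (a , (v ≤ᵇ a))) f s) (parkK k n f)

sameType : Bool → Bool → Bool
sameType true t' = t'
sameType false t' = not t'

groupTypes : List (ℕ × Bool) → List (Bool × List ℕ)
groupTypes [] = []
groupTypes ((a , t) ∷ xs) with groupTypes xs
... | [] = (t , a ∷ []) ∷ []
... | (t' , b) ∷ rest =
  if sameType t t' then (t , a ∷ b) ∷ rest
  else (t , a ∷ []) ∷ (t' , b) ∷ rest

kDecomposition : ℕ → ℕ → List ℕ → Maybe (List (Bool × List ℕ))
kDecomposition k n f = mapMaybe groupTypes (typed k n f)

-- ν_i: backward blocks (the odd-indexed ones) p ↦ n+1-p,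
-- forward blocks (the even-indexed ones) p ↦ p-k
ν : ℕ → ℕ → Bool × List ℕ → List ℕ
ν n k (true , b) = map (λ p → suc n ∸ p) b
ν n k (false , b) = map (λ p → p ∸ k) b

-- Ξ_i = Φ_{ℓ_i,n}(Ξ_{i-1}) ⊕ ν_i, starting from Ξ_0 = [] (Φ of the
-- empty tuple is empty, so Ξ_1 = ν_1)
ΞStep : ℕ → ℕ → Maybe (List ℕ) → Bool × List ℕ → Maybe (List ℕ)
ΞStep n k acc blk = acc >>= λ x → mapMaybe (_++ ν n k blk) (Φ n x)

Ξ : ℕ → ℕ → ℕ → List ℕ → Maybe (List ℕ)
Ξ m n k f = kDecomposition k n f >>= λ bs → foldl (ΞStep n k) (just []) bs

module Submission where

-- For f ∈ B(m,n;k) and x = Ξ(f) both runs succeed, every car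
-- has the same type in both (Naples: it parks at or before its preference; classical: it
-- parks at most k after it), and the occupied sets agree if the last car is forward-type and
-- are mirror images (v ↔ n + 1 - v) if it is backward-type.  A new backward-type car
-- preferring a then acts in the mirrored lot like a classical car preferring n + 1 - a; a
-- forward-type car has a > k by containment, finds a - k, ..., a - 1 occupied and acts like
-- a classical car preferring a - k.  When the type changes, Ξ first applies Φ, which moves
-- each parking component to its mirror position: this keeps all displacements, hence all
-- types, and mirrors the occupied set, so the invariant survives.  Since Φ is an involution
-- and the types can be read off the image, the last car of a preimage is determined and
-- can be reconstructed, which gives injectivity and surjectivity.

open import Defs
open import Data.Nat
open import Data.Nat.Properties
open import Data.Bool using (Bool; true; false; if_then_else_; not; _∧_; _∨_; T)
open import Data.Bool.Properties using (∨-assoc; ∨-comm; ∨-identityʳ; ∨-conicalˡ; ∨-conicalʳ; ∧-conicalˡ; ∧-conicalʳ)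
open import Data.List using (List; []; _∷_; _++_; _∷ʳ_; map; applyUpTo; filterᵇ; reverse; length; foldl; zip; zipWith)
open import Data.List.Properties
  using (map-++; unfold-reverse; ++-assoc; ++-identityʳ; ++-conicalʳ; ∷ʳ-injective; length-++; length-map; zip-map; map-cong)
open import Data.List.Reverse using (Reverse; []; _∶_∶ʳ_; reverseView)
open import Data.List.Relation.Unary.All using ([]; _∷_)
open import Data.List.Relation.Unary.All.Properties using (++⁺; ++⁻ˡ)
open import Data.List.Relation.Unary.Any using (here; there)
open import Data.List.Membership.Propositional using (_∈_; _∉_)
open import Data.List.Membership.Propositional.Properties using (∈-map⁺; ∈-map⁻)
open import Data.Maybe using (Maybe; just; nothing; _>>=_) renaming (map to mapMaybe)
open import Data.Maybe.Properties using (just-injective)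
open import Data.Product using (Σ; ∃; _×_; _,_; proj₁; proj₂)
open import Data.Sum using (_⊎_; inj₁; inj₂)
open import Data.Empty using (⊥; ⊥-elim)
open import Data.Unit using (tt)
open import Relation.Binary.PropositionalEquality
open import Relation.Binary.Definitions using (tri<; tri≈; tri>)
open import Relation.Nullary using (¬_; yes; no)

≡ᵇ-refl : ∀ x → (x ≡ᵇ x) ≡ true
≡ᵇ-refl zero = refl
≡ᵇ-refl (suc x) = ≡ᵇ-refl x

≡ᵇ-true⇒≡ : ∀ {x y} → (x ≡ᵇ y) ≡ true → x ≡ y
≡ᵇ-true⇒≡ {x} {y} e = ≡ᵇ⇒≡ x y (subst T (sym e) tt)

≤ᵇ-true⇒≤ : ∀ {m n} → (m ≤ᵇ n) ≡ true → m ≤ n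
≤ᵇ-true⇒≤ {m} {n} e = ≤ᵇ⇒≤ m n (subst T (sym e) tt)

≤⇒≤ᵇ-true : ∀ {m n} → m ≤ n → (m ≤ᵇ n) ≡ true
≤⇒≤ᵇ-true {m} {n} le with m ≤ᵇ n in eq
... | true = refl
... | false = ⊥-elim (subst T eq (≤⇒≤ᵇ le))

>⇒≤ᵇ-false : ∀ {m n} → n < m → (m ≤ᵇ n) ≡ false
>⇒≤ᵇ-false {m} {n} lt with m ≤ᵇ n in eq
... | false = refl
... | true = ⊥-elim (<⇒≱ lt (≤ᵇ-true⇒≤ eq))

≤ᵇ-false⇒> : ∀ {m n} → (m ≤ᵇ n) ≡ false → n < m
≤ᵇ-false⇒> {m} {n} e with m ≤? n
... | yes le with () ← trans (sym (≤⇒≤ᵇ-true le)) e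
... | no nle = ≰⇒> nle

true≢false : true ≢ false
true≢false ()

∨-true⁻ : ∀ {a b} → (a ∨ b) ≡ true → a ≡ true ⊎ b ≡ true
∨-true⁻ {true} e = inj₁ refl
∨-true⁻ {false} e = inj₂ e

∨-trueʳ : ∀ a {b} → b ≡ true → (a ∨ b) ≡ true
∨-trueʳ true refl = refl
∨-trueʳ false refl = refl

bool-split : ∀ (b : Bool) → b ≡ true ⊎ b ≡ false
bool-split true = inj₁ refl
bool-split false = inj₂ refl

bool-ext : ∀ {a b : Bool} → (a ≡ true → b ≡ true) → (b ≡ true → a ≡ true) → a ≡ b
bool-ext {true} {true} f g = refl
bool-ext {true} {false} f g = sym (f refl)
bool-ext {false} {true} f g = g refl
bool-ext {false} {false} f g = refl

memb-++ : ∀ v xs ys → memb v (xs ++ ys) ≡ (memb v xs ∨ memb v ys)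
memb-++ v [] ys = refl
memb-++ v (x ∷ xs) ys rewrite memb-++ v xs ys = sym (∨-assoc (x ≡ᵇ v) (memb v xs) (memb v ys))

memb-∷ʳ : ∀ v xs u → memb v (xs ∷ʳ u) ≡ (memb v xs ∨ (u ≡ᵇ v))
memb-∷ʳ v xs u rewrite memb-++ v xs (u ∷ []) = cong (memb v xs ∨_) (∨-identityʳ (u ≡ᵇ v))

memb-reverse : ∀ v xs → memb v (reverse xs) ≡ memb v xs
memb-reverse v [] = refl
memb-reverse v (x ∷ xs) rewrite unfold-reverse x xs | memb-∷ʳ v (reverse xs) x | memb-reverse v xs =
  ∨-comm (memb v xs) (x ≡ᵇ v)

memb-false⇒∉ : ∀ {v xs} → memb v xs ≡ false → v ∉ xs
memb-false⇒∉ {v} {x ∷ xs} e (here refl) = true≢false (trans (sym (≡ᵇ-refl v)) (∨-conicalˡ (v ≡ᵇ v) _ e))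
memb-false⇒∉ {v} {x ∷ xs} e (there p) = memb-false⇒∉ (∨-conicalʳ (x ≡ᵇ v) _ e) p

∈⇒memb-true : ∀ {v xs} → v ∈ xs → memb v xs ≡ true
∈⇒memb-true {v} {x ∷ xs} (here refl) rewrite ≡ᵇ-refl v = refl
∈⇒memb-true {v} {x ∷ xs} (there p) = ∨-trueʳ (x ≡ᵇ v) (∈⇒memb-true p)

memb-true⇒∈ : ∀ {v xs} → memb v xs ≡ true → v ∈ xs
memb-true⇒∈ {v} {x ∷ xs} e with ∨-true⁻ {x ≡ᵇ v} e
... | inj₁ p = here (sym (≡ᵇ-true⇒≡ p))
... | inj₂ p = there (memb-true⇒∈ p)

∉⇒memb-false : ∀ {v xs} → v ∉ xs → memb v xs ≡ false
∉⇒memb-false {v} {xs} v∉ with bool-split (memb v xs)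
... | inj₂ f = f
... | inj₁ t = ⊥-elim (v∉ (memb-true⇒∈ t))

memb-map⁺ : ∀ (f : ℕ → ℕ) {w} xs → memb w xs ≡ true → memb (f w) (map f xs) ≡ true
memb-map⁺ f {w} xs e = ∈⇒memb-true {f w} {map f xs} (∈-map⁺ f (memb-true⇒∈ {w} {xs} e))

memb-map⁻ : ∀ (f : ℕ → ℕ) {y} xs → memb y (map f xs) ≡ true → Σ ℕ λ w → memb w xs ≡ true × f w ≡ y
memb-map⁻ f xs e with ∈-map⁻ f (memb-true⇒∈ {xs = map f xs} e)
... | w , i , eq = w , ∈⇒memb-true i , sym eq

≤ᵇ-+-cancelˡ : ∀ a d k → (a + d ≤ᵇ a + k) ≡ (d ≤ᵇ k)
≤ᵇ-+-cancelˡ a d k with d ≤? k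
... | yes p rewrite ≤⇒≤ᵇ-true p = ≤⇒≤ᵇ-true (+-monoʳ-≤ a p)
... | no p rewrite >⇒≤ᵇ-false (≰⇒> p) = >⇒≤ᵇ-false (+-monoʳ-< a (≰⇒> p))

length-init : ∀ {A : Set} (xs : List A) {x ℓ} → length (xs ∷ʳ x) ≡ suc ℓ → length xs ≡ ℓ
length-init xs e = suc-injective (trans (+-comm 1 (length xs)) (trans (sym (length-++ xs)) e))

∷ʳ≢[] : ∀ {A : Set} (xs : List A) {x} → xs ∷ʳ x ≢ []
∷ʳ≢[] xs e with () ← ++-conicalʳ xs _ e

zipWith-∷ʳ : ∀ {A B C : Set} (g : A → B → C) xs ys a b → length xs ≡ length ys →
  zipWith g (xs ∷ʳ a) (ys ∷ʳ b) ≡ zipWith g xs ys ∷ʳ g a b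
zipWith-∷ʳ g [] [] a b e = refl
zipWith-∷ʳ g (x ∷ xs) (y ∷ ys) a b e = cong (g x y ∷_) (zipWith-∷ʳ g xs ys a b (suc-injective e))

zipWith-map-invariant : ∀ (f : ℕ → ℕ → Bool) (g : ℕ → ℕ) xs ys →
  (∀ p s → (p , s) ∈ zip xs ys → f (g p) (g s) ≡ f p s) → zipWith f (map g xs) (map g ys) ≡ zipWith f xs ys
zipWith-map-invariant f g [] ys h = refl
zipWith-map-invariant f g (x ∷ xs) [] h = refl
zipWith-map-invariant f g (x ∷ xs) (y ∷ ys) h =
  cong₂ _∷_ (h x y (here refl)) (zipWith-map-invariant f g xs ys (λ p s i → h p s (there i)))

run-∷ʳ : ∀ (step : List ℕ → ℕ → Maybe ℕ) occ xs a →
  run step occ (xs ∷ʳ a) ≡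
  (run step occ xs >>= λ ss → mapMaybe (ss ∷ʳ_) (step (reverse ss ++ occ) a))
run-∷ʳ step occ [] a with step occ a
... | nothing = refl
... | just v = refl
run-∷ʳ step occ (b ∷ xs) a with step occ b
... | nothing = refl
... | just v rewrite run-∷ʳ step (v ∷ occ) xs a with run step (v ∷ occ) xs
... | nothing = refl
... | just ss rewrite unfold-reverse v ss | ++-assoc (reverse ss) (v ∷ []) occ
    with step (reverse ss ++ v ∷ occ) a
... | nothing = refl
... | just u = refl

run-length : ∀ step occ xs {ss} → run step occ xs ≡ just ss → length ss ≡ length xs
run-length step occ [] refl = refl
run-length step occ (a ∷ xs) e with step occ a
... | just v with run step (v ∷ occ) xs in eq
... | just ss with refl ← e = cong suc (run-length step (v ∷ occ) xs eq)

run-∷ : ∀ (step : List ℕ → ℕ → _) occ a {u} xs {ss} → step occ a ≡ just u → run step (u ∷ occ) xs ≡ just ss →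
  run step occ (a ∷ xs) ≡ just (u ∷ ss)
run-∷ step occ a xs e1 e2 rewrite e1 | e2 = refl

-- the occupied list after the cars of a prefix have parked at the spots S
occupied : List ℕ → List ℕ
occupied S = reverse S ++ []

memb-occupied : ∀ v S → memb v (occupied S) ≡ memb v S
memb-occupied v S = trans (cong (memb v) (++-identityʳ (reverse S))) (memb-reverse v S)

run-∷ʳ⁺ : ∀ (step : List ℕ → ℕ → Maybe ℕ) xs {a ss v} → run step [] xs ≡ just ss → step (occupied ss) a ≡ just v →
  run step [] (xs ∷ʳ a) ≡ just (ss ∷ʳ v)
run-∷ʳ⁺ step xs {a} e₁ e₂ rewrite run-∷ʳ step [] xs a | e₁ | e₂ = refl

run-∷ʳ⁻ : ∀ (step : List ℕ → ℕ → Maybe ℕ) xs a {ss′} → run step [] (xs ∷ʳ a) ≡ just ss′ →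
  Σ (List ℕ) λ ss → Σ ℕ λ v → run step [] xs ≡ just ss × step (occupied ss) a ≡ just v × ss′ ≡ ss ∷ʳ v
run-∷ʳ⁻ step xs a e rewrite run-∷ʳ step [] xs a with run step [] xs
... | just ss with step (occupied ss) a in e₂
... | just v with refl ← e = ss , v , refl , e₂ , refl

-- The classical and the Naples step

applyUpTo-cong : ∀ {A : Set} {f g : ℕ → A} c → (∀ i → f i ≡ g i) → applyUpTo f c ≡ applyUpTo g c
applyUpTo-cong zero h = refl
applyUpTo-cong (suc c) h = cong₂ _∷_ (h 0) (applyUpTo-cong c (λ i → h (suc i)))

map-applyUpTo : ∀ {A B : Set} (f : A → B) (g : ℕ → A) c → map f (applyUpTo g c) ≡ applyUpTo (λ i → f (g i)) c
map-applyUpTo f g zero = refl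
map-applyUpTo f g (suc c) = cong (f (g 0) ∷_) (map-applyUpTo f (λ i → g (suc i)) c)

applyUpTo-+-suc : ∀ s c → applyUpTo (s +_) (suc c) ≡ s ∷ applyUpTo (suc s +_) c
applyUpTo-+-suc s c = cong₂ _∷_ (+-identityʳ s) (applyUpTo-cong c (λ i → +-suc s i))

range-applyUpTo : ∀ s n → range s n ≡ applyUpTo (s +_) (suc n ∸ s)
range-applyUpTo s n = map-applyUpTo (s +_) (λ i → i) (suc n ∸ s)

FirstFreeFrom : List ℕ → ℕ → ℕ → ℕ → Set
FirstFreeFrom occ s c u =
  s ≤ u × u < s + c × memb u occ ≡ false × (∀ w → s ≤ w → w < u → memb w occ ≡ true)

firstFree-interval-sound : ∀ occ s c {u} → firstFree occ (applyUpTo (s +_) c) ≡ just u → FirstFreeFrom occ s c u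
firstFree-interval-sound occ s zero ()
firstFree-interval-sound occ s (suc c) {u} e = from-cons (trans (sym (cong (firstFree occ) (applyUpTo-+-suc s c))) e)
  where
  from-cons : firstFree occ (s ∷ applyUpTo (suc s +_) c) ≡ just u → FirstFreeFrom occ s (suc c) u
  from-cons e′ with memb s occ in em
  ... | false with refl ← e′ =
    ≤-refl , subst (s <_) (sym (+-suc s c)) (s≤s (m≤m+n s c)) , em , (λ w sw wu → ⊥-elim (<⇒≱ wu sw))
  ... | true with firstFree-interval-sound occ (suc s) c e′
  ... | su , uc , uf , occd = <⇒≤ su , subst (u <_) (sym (+-suc s c)) uc , uf , occd′
    where
    occd′ : ∀ w → s ≤ w → w < u → memb w occ ≡ true
    occd′ w sw wu with m≤n⇒m<n∨m≡n sw
    ... | inj₁ lt = occd w lt wu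
    ... | inj₂ refl = em

firstFree-interval-complete : ∀ occ s c {u} → FirstFreeFrom occ s c u → firstFree occ (applyUpTo (s +_) c) ≡ just u
firstFree-interval-complete occ s zero (su , uc , _) = ⊥-elim (<⇒≱ uc (subst (_≤ _) (sym (+-identityʳ s)) su))
firstFree-interval-complete occ s (suc c) {u} (su , uc , uf , occd) =
  trans (cong (firstFree occ) (applyUpTo-+-suc s c)) to-cons
  where
  to-cons : firstFree occ (s ∷ applyUpTo (suc s +_) c) ≡ just u
  to-cons with m≤n⇒m<n∨m≡n su
  ... | inj₂ refl rewrite uf = refl
  ... | inj₁ lt rewrite occd s ≤-refl lt =
    firstFree-interval-complete occ (suc s) c (lt , subst (u <_) (+-suc s c) uc , uf , (λ w sw wu → occd w (<⇒≤ sw) wu))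

inLot-true : ∀ {n a} → 1 ≤ a → a ≤ n → inLot n a ≡ true
inLot-true p q rewrite ≤⇒≤ᵇ-true p | ≤⇒≤ᵇ-true q = refl

inLot-true⁻ : ∀ {n a} → inLot n a ≡ true → 1 ≤ a × a ≤ n
inLot-true⁻ {n} {a} e = ≤ᵇ-true⇒≤ (∧-conicalˡ (1 ≤ᵇ a) _ e) , ≤ᵇ-true⇒≤ (∧-conicalʳ (1 ≤ᵇ a) _ e)

ForwardFree : ℕ → List ℕ → ℕ → ℕ → Set
ForwardFree n occ a w = w ≤ n × memb w occ ≡ false × (∀ x → a < x → x < w → memb x occ ≡ true)

firstFree-after-sound : ∀ n occ a {w} → a ≤ n → firstFree occ (range (suc a) n) ≡ just w → a < w × ForwardFree n occ a w
firstFree-after-sound n occ a {w} an e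
  with firstFree-interval-sound occ (suc a) (n ∸ a) (trans (sym (cong (firstFree occ) (range-applyUpTo (suc a) n))) e)
... | aw , wn , wf , occd = aw , s≤s⁻¹ (subst (w <_) (cong suc (m+[n∸m]≡n an)) wn) , wf , occd

firstFree-after-complete : ∀ n occ a {w} → a ≤ n → a < w → ForwardFree n occ a w → firstFree occ (range (suc a) n) ≡ just w
firstFree-after-complete n occ a {w} an aw (wn , wf , occd) =
  trans (cong (firstFree occ) (range-applyUpTo (suc a) n))
    (firstFree-interval-complete occ (suc a) (n ∸ a) (aw , s≤s (subst (w ≤_) (sym (m+[n∸m]≡n an)) wn) , wf , occd))

ClassicalSpot : ℕ → List ℕ → ℕ → ℕ → Set
ClassicalSpot n occ a u = 1 ≤ a × a ≤ u × u ≤ n × memb u occ ≡ false × (∀ w → a ≤ w → w < u → memb w occ ≡ true)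

classicalStep-sound : ∀ n occ a {u} → classicalStep n occ a ≡ just u → ClassicalSpot n occ a u
classicalStep-sound n occ a e with inLot n a in eL
... | true with inLot-true⁻ {n} {a} eL
... | 1a , an with memb a occ in em
... | false with refl ← e = 1a , ≤-refl , an , em , (λ w aw wa → ⊥-elim (<⇒≱ wa aw))
... | true with firstFree-after-sound n occ a an e
... | au , un , uf , occd = 1a , <⇒≤ au , un , uf , occd′
  where
  occd′ : ∀ w → a ≤ w → w < _ → memb w occ ≡ true
  occd′ w aw wu with m≤n⇒m<n∨m≡n aw
  ... | inj₁ lt = occd w lt wu
  ... | inj₂ refl = em

classicalStep-complete : ∀ n occ a {u} → ClassicalSpot n occ a u → classicalStep n occ a ≡ just u
classicalStep-complete n occ a (1a , au , un , uf , occd) rewrite inLot-true {n} {a} 1a (≤-trans au un)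
  with m≤n⇒m<n∨m≡n au
... | inj₂ refl rewrite uf = refl
... | inj₁ lt rewrite occd a ≤-refl lt =
  firstFree-after-complete n occ a (≤-trans au un) lt (un , uf , λ w aw wu → occd w (<⇒≤ aw) wu)

BackFree : ℕ → List ℕ → ℕ → ℕ → Set
BackFree k occ a w = 1 ≤ w × a ≤ w + k × memb w occ ≡ false × (∀ x → w < x → x < a → memb x occ ≡ true)

BackFull : ℕ → List ℕ → ℕ → Set
BackFull k occ a = ∀ x → 1 ≤ x → x < a → a ≤ x + k → memb x occ ≡ true

backCands′ : ℕ → ℕ → List ℕ
backCands′ b k = filterᵇ (λ v → 1 ≤ᵇ v) (applyUpTo (b ∸_) k)

backCands′-zero : ∀ k → backCands′ 0 k ≡ []
backCands′-zero zero = refl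
backCands′-zero (suc k) =
  trans (cong (filterᵇ (λ v → 1 ≤ᵇ v)) (applyUpTo-cong k (λ i → trans (0∸n≡0 (suc i)) (sym (0∸n≡0 i)))))
        (backCands′-zero k)

backCands-suc : ∀ k b → backCands k (suc b) ≡ backCands′ b k
backCands-suc k b = cong (filterᵇ (λ v → 1 ≤ᵇ v))
  (trans (cong (map (suc b ∸_)) (map-applyUpTo (1 +_) (λ i → i) k)) (map-applyUpTo (suc b ∸_) suc k))

backCands′-just : ∀ occ k b {w} → firstFree occ (backCands′ b k) ≡ just w → w < suc b × BackFree k occ (suc b) w
backCands′-just occ zero b ()
backCands′-just occ (suc k) zero e rewrite backCands′-zero (suc k) with () ← e
backCands′-just occ (suc k) (suc b) e with memb (suc b) occ in em
... | false with refl ← e =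
  ≤-refl , s≤s z≤n , s≤s (subst (suc b ≤_) (sym (+-suc b k)) (s≤s (m≤m+n b k))) , em , (λ x wx xa → ⊥-elim (<⇒≱ xa wx))
... | true with backCands′-just occ k b e
... | wb , 1w , bwk , wf , occd = m≤n⇒m≤1+n wb , 1w , subst (suc (suc b) ≤_) (sym (+-suc _ k)) (s≤s bwk) , wf , occd′
  where
  occd′ : ∀ x → _ < x → x < suc (suc b) → memb x occ ≡ true
  occd′ x wx xa with m≤n⇒m<n∨m≡n (s≤s⁻¹ xa)
  ... | inj₁ lt = occd x wx lt
  ... | inj₂ refl = em

backCands′-nothing : ∀ occ k b → firstFree occ (backCands′ b k) ≡ nothing → BackFull k occ (suc b)
backCands′-nothing occ zero b e x 1x xa ak = ⊥-elim (<⇒≱ xa (subst (suc b ≤_) (+-identityʳ x) ak))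
backCands′-nothing occ (suc k) zero e x 1x xa ak = ⊥-elim (<⇒≱ xa 1x)
backCands′-nothing occ (suc k) (suc b) e x 1x xa ak with memb (suc b) occ in em
... | false with () ← e
... | true with m≤n⇒m<n∨m≡n (s≤s⁻¹ xa)
... | inj₂ refl = em
... | inj₁ lt = backCands′-nothing occ k b e x 1x lt (s≤s⁻¹ (subst (suc (suc b) ≤_) (+-suc x k) ak))

backCands′-complete : ∀ occ k b {w} → w < suc b → BackFree k occ (suc b) w → firstFree occ (backCands′ b k) ≡ just w
backCands′-complete occ zero b wb (1w , ak , wf , occd) = ⊥-elim (<⇒≱ wb (subst (suc b ≤_) (+-identityʳ _) ak))
backCands′-complete occ (suc k) zero wb (1w , ak , wf , occd) = ⊥-elim (<⇒≱ wb 1w)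
backCands′-complete occ (suc k) (suc b) wb (1w , ak , wf , occd) with m≤n⇒m<n∨m≡n (s≤s⁻¹ wb)
... | inj₂ refl rewrite wf = refl
... | inj₁ lt rewrite occd (suc b) lt ≤-refl =
  backCands′-complete occ k b lt (1w , s≤s⁻¹ (subst (suc (suc b) ≤_) (+-suc _ k) ak) , wf , (λ x wx xa → occd x wx (m≤n⇒m≤1+n xa)))

NaplesSpot : ℕ → ℕ → List ℕ → ℕ → ℕ → Set
NaplesSpot k n occ a w = (w ≡ a × memb a occ ≡ false)
  ⊎ (memb a occ ≡ true × w < a × BackFree k occ a w)
  ⊎ (memb a occ ≡ true × BackFull k occ a × a < w × ForwardFree n occ a w)

naplesStep-sound : ∀ k n occ a {w} → naplesStep k n occ a ≡ just w → 1 ≤ a × a ≤ n × NaplesSpot k n occ a w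
naplesStep-sound k n occ a e with inLot n a in eL
... | true with inLot-true⁻ {n} {a} eL
naplesStep-sound k n occ (suc b) e | true | 1a , an with memb (suc b) occ in em
... | false with refl ← e = 1a , an , inj₁ (refl , refl)
... | true rewrite backCands-suc k b with firstFree occ (backCands′ b k) in eb
... | just v with refl ← e = 1a , an , inj₂ (inj₁ (refl , backCands′-just occ k b eb))
... | nothing with firstFree-after-sound n occ (suc b) an e
... | aw , fwd = 1a , an , inj₂ (inj₂ (refl , backCands′-nothing occ k b eb , aw , fwd))

naplesStep-preferred : ∀ k n occ a → 1 ≤ a → a ≤ n → memb a occ ≡ false → naplesStep k n occ a ≡ just a
naplesStep-preferred k n occ a 1a an af rewrite inLot-true {n} {a} 1a an | af = refl

naplesStep-back : ∀ k n occ a {w} → 1 ≤ a → a ≤ n → memb a occ ≡ true → w < a → BackFree k occ a w →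
  naplesStep k n occ a ≡ just w
naplesStep-back k n occ (suc b) 1a an at wa bf
  rewrite inLot-true {n} {suc b} 1a an | at | backCands-suc k b | backCands′-complete occ k b wa bf = refl

naplesStep-forward : ∀ k n occ a {w} → 1 ≤ a → a ≤ n → memb a occ ≡ true → BackFull k occ a → a < w →
  ForwardFree n occ a w → naplesStep k n occ a ≡ just w
naplesStep-forward k n occ (suc b) 1a an at full aw fwd
  rewrite inLot-true {n} {suc b} 1a an | at | backCands-suc k b with firstFree occ (backCands′ b k) in eb
... | just v with vb , 1v , bvk , vf , _ ← backCands′-just occ k b eb =
  ⊥-elim (true≢false (trans (sym (full v 1v vb bvk)) vf))
... | nothing = firstFree-after-complete n occ (suc b) an aw fwd

naplesStep-inLot : ∀ k n occ a {w} → naplesStep k n occ a ≡ just w → 1 ≤ w × w ≤ n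
naplesStep-inLot k n occ a e with naplesStep-sound k n occ a e
... | 1a , an , inj₁ (refl , _) = 1a , an
... | 1a , an , inj₂ (inj₁ (_ , wa , 1w , _)) = 1w , ≤-trans (<⇒≤ wa) an
... | 1a , an , inj₂ (inj₂ (_ , _ , aw , wn , _)) = ≤-trans 1a (<⇒≤ aw) , wn

∸-split : ∀ {l p w} → l ≤ p → p ≤ w → w ∸ l ≡ (p ∸ l) + (w ∸ p)
∸-split {l} {p} {w} lp pw = begin
  w ∸ l               ≡⟨ cong (_∸ l) (sym (m∸n+n≡m pw)) ⟩
  (w ∸ p) + p ∸ l     ≡⟨ +-∸-assoc (w ∸ p) lp ⟩
  (w ∸ p) + (p ∸ l)   ≡⟨ +-comm (w ∸ p) (p ∸ l) ⟩
  (p ∸ l) + (w ∸ p)   ∎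
  where open ≡-Reasoning

∸-+-≤ : ∀ N {l v h} → l ≤ v → v ≤ h → h ≤ N → (N ∸ h) + (v ∸ l) ≤ N ∸ l
∸-+-≤ N {l} {v} {h} lv vh hN = ≤-trans (+-monoʳ-≤ (N ∸ h) (∸-monoˡ-≤ l vh))
  (≤-reflexive (trans (+-comm (N ∸ h) (h ∸ l)) (sym (∸-split (≤-trans lv vh) hN))))

+-≤⇒≤-∸ : ∀ {L α p} → L + α ≤ p → α ≤ p ∸ L
+-≤⇒≤-∸ {L} {α} {p} le = subst (_≤ p ∸ L) (m+n∸m≡n L α) (∸-monoˡ-≤ L le)

∸-≤⇒≤-+ : ∀ {L β p} → L ≤ p → p ∸ L ≤ β → p ≤ L + β
∸-≤⇒≤-+ {L} {β} {p} lp le = subst (_≤ L + β) (m+[n∸m]≡n lp) (+-monoʳ-≤ L le)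

1≤suc-∸ : ∀ {h n} → h ≤ n → 1 ≤ suc n ∸ h
1≤suc-∸ {h} {n} hn = subst (_≤ suc n ∸ h) (m+n∸n≡m 1 n) (∸-monoʳ-≤ (suc n) hn)

-- L + (H - w) is the mirror image of w in [L, H]; reflecting it lands on N - w.
mirror-in-interval : ∀ {L w H N} → L ≤ w → w ≤ H → H ≤ N → N ∸ ((N ∸ H) + (w ∸ L)) ≡ L + (H ∸ w)
mirror-in-interval {L} {w} {H} {N} Lw wH HN = begin
  N ∸ ((N ∸ H) + (w ∸ L)) ≡⟨ sym (∸-+-assoc N (N ∸ H) (w ∸ L)) ⟩
  N ∸ (N ∸ H) ∸ (w ∸ L)   ≡⟨ cong (_∸ (w ∸ L)) (m∸[m∸n]≡n HN) ⟩
  H ∸ (w ∸ L)             ≡⟨ cong (_∸ (w ∸ L)) (sym (m∸n+n≡m wH)) ⟩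
  (H ∸ w) + w ∸ (w ∸ L)   ≡⟨ +-∸-assoc (H ∸ w) (m∸n≤m w L) ⟩
  (H ∸ w) + (w ∸ (w ∸ L)) ≡⟨ cong ((H ∸ w) +_) (m∸[m∸n]≡n Lw) ⟩
  (H ∸ w) + L             ≡⟨ +-comm (H ∸ w) L ⟩
  L + (H ∸ w)             ∎
  where open ≡-Reasoning

reflect-mirror-in-interval : ∀ {L w H N} → L ≤ w → w ≤ H → H ≤ N → (N ∸ H) + ((L + (H ∸ w)) ∸ L) ≡ N ∸ w
reflect-mirror-in-interval {L} {w} {H} {N} Lw wH HN = begin
  (N ∸ H) + ((L + (H ∸ w)) ∸ L) ≡⟨ cong ((N ∸ H) +_) (m+n∸m≡n L (H ∸ w)) ⟩
  (N ∸ H) + (H ∸ w)             ≡⟨ +-comm (N ∸ H) (H ∸ w) ⟩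
  (H ∸ w) + (N ∸ H)             ≡⟨ sym (∸-split wH HN) ⟩
  N ∸ w                         ∎
  where open ≡-Reasoning

mirror-displacement : ∀ {w a N k} → w ≤ a → a ≤ N → a ≤ w + k → N ∸ w ≤ (N ∸ a) + k
mirror-displacement {w} {a} {N} {k} wa aN awk = begin
  N ∸ w              ≡⟨ ∸-split wa aN ⟩
  (a ∸ w) + (N ∸ a)  ≤⟨ +-monoˡ-≤ (N ∸ a) (m≤n+o⇒m∸n≤o a w awk) ⟩
  k + (N ∸ a)        ≡⟨ +-comm k (N ∸ a) ⟩
  (N ∸ a) + k        ∎
  where open ≤-Reasoning

-- Parking components

Paths : Set
Paths = List (ℕ × ℕ)

Overlaps : ℕ → ℕ → ℕ → ℕ → Set
Overlaps lo hi p s = p ≤ hi × lo ≤ s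

Closed : Paths → ℕ → ℕ → Set
Closed ps lo hi = ∀ p s → (p , s) ∈ ps → Overlaps lo hi p s → lo ≤ p × s ≤ hi

-- the local step of Defs.grow, with which it agrees definitionally
growStep : ℕ → ℕ → ℕ × ℕ → ℕ × ℕ → ℕ × ℕ
growStep lo hi (l , h) (p , s) = if (p ≤ᵇ hi) ∧ (lo ≤ᵇ s) then (l ⊓ p , h ⊔ s) else (l , h)

growStep-overlap : ∀ {lo hi l h p s} → Overlaps lo hi p s → growStep lo hi (l , h) (p , s) ≡ (l ⊓ p , h ⊔ s)
growStep-overlap (a , b) rewrite ≤⇒≤ᵇ-true a | ≤⇒≤ᵇ-true b = refl

growStep-disjoint : ∀ {lo hi l h p s} → ¬ Overlaps lo hi p s → growStep lo hi (l , h) (p , s) ≡ (l , h)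
growStep-disjoint {lo} {hi} {p = p} {s} ne with p ≤? hi | lo ≤? s
... | yes a | yes b = ⊥-elim (ne (a , b))
... | no a | _ rewrite >⇒≤ᵇ-false (≰⇒> a) = refl
... | yes a | no b rewrite ≤⇒≤ᵇ-true a | >⇒≤ᵇ-false (≰⇒> b) = refl

GrowSpec : ℕ → ℕ → Paths → ℕ × ℕ → ℕ × ℕ → Set
GrowSpec lo hi qs (l , h) (rl , rh) =
  rl ≤ l × h ≤ rh
  × (∀ p s → (p , s) ∈ qs → Overlaps lo hi p s → rl ≤ p × s ≤ rh)
  × (∀ L H → L ≤ l → h ≤ H → (∀ p s → (p , s) ∈ qs → Overlaps lo hi p s → L ≤ p × s ≤ H) → L ≤ rl × rh ≤ H)

private
  after : ∀ {lo hi qs l h p s z} → z ≡ growStep lo hi (l , h) (p , s) →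
    GrowSpec lo hi ((p , s) ∷ qs) (l , h) (foldl (growStep lo hi) z qs) →
    GrowSpec lo hi ((p , s) ∷ qs) (l , h) (foldl (growStep lo hi) (l , h) ((p , s) ∷ qs))
  after refl g = g

  GrowSpec-skip : ∀ {lo hi p s qs l h r} → ¬ Overlaps lo hi p s → GrowSpec lo hi qs (l , h) r →
    GrowSpec lo hi ((p , s) ∷ qs) (l , h) r
  GrowSpec-skip {lo} {hi} {p} {s} {qs} {r = rl , rh} disjoint (g1 , g2 , g3 , g4) =
    g1 , g2 , absorbs , (λ L H x y bound → g4 L H x y (λ p′ s′ i → bound p′ s′ (there i)))
    where
    absorbs : ∀ p′ s′ → (p′ , s′) ∈ (p , s) ∷ qs → Overlaps lo hi p′ s′ → rl ≤ p′ × s′ ≤ rh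
    absorbs p′ s′ (here refl) o = ⊥-elim (disjoint o)
    absorbs p′ s′ (there i) o = g3 p′ s′ i o

growStep-spec : ∀ lo hi qs z → GrowSpec lo hi qs z (foldl (growStep lo hi) z qs)
growStep-spec lo hi [] (l , h) = ≤-refl , ≤-refl , (λ p s ()) , (λ L H a b _ → a , b)
growStep-spec lo hi ((p , s) ∷ qs) (l , h) with p ≤? hi | lo ≤? s
... | yes a | yes b = after (sym (growStep-overlap (a , b))) (widen (growStep-spec lo hi qs (l ⊓ p , h ⊔ s)))
  where
  widen : ∀ {r} → GrowSpec lo hi qs (l ⊓ p , h ⊔ s) r → GrowSpec lo hi ((p , s) ∷ qs) (l , h) r
  widen (g1 , g2 , g3 , g4) = ≤-trans g1 (m⊓n≤m l p) , ≤-trans (m≤m⊔n h s) g2 , absorbs , least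
    where
    absorbs : ∀ p′ s′ → (p′ , s′) ∈ (p , s) ∷ qs → Overlaps lo hi p′ s′ → _
    absorbs p′ s′ (here refl) _ = ≤-trans g1 (m⊓n≤n l p) , ≤-trans (m≤n⊔m h s) g2
    absorbs p′ s′ (there i) o = g3 p′ s′ i o
    least : ∀ L H → L ≤ l → h ≤ H →
      (∀ p′ s′ → (p′ , s′) ∈ (p , s) ∷ qs → Overlaps lo hi p′ s′ → L ≤ p′ × s′ ≤ H) → _
    least L H Ll hH bound with bound p s (here refl) (a , b)
    ... | Lp , sH = g4 L H (⊓-glb Ll Lp) (⊔-lub hH sH) (λ p′ s′ i → bound p′ s′ (there i))
... | no a | _ = after (sym (growStep-disjoint {lo} na)) (GrowSpec-skip na (growStep-spec lo hi qs (l , h)))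
  where na = λ o → a (proj₁ o)
... | yes a | no b = after (sym (growStep-disjoint {lo} nb)) (GrowSpec-skip nb (growStep-spec lo hi qs (l , h)))
  where nb = λ o → b (proj₂ o)

inside : ℕ → ℕ → ℕ → ℕ → ℕ
inside lo hi p s = if (lo ≤ᵇ p) ∧ (s ≤ᵇ hi) then 1 else 0

-- bounds the number of growth passes needed
countInside : Paths → ℕ → ℕ → ℕ
countInside [] lo hi = 0
countInside ((p , s) ∷ qs) lo hi = inside lo hi p s + countInside qs lo hi

inside-yes : ∀ {lo hi p s} → lo ≤ p → s ≤ hi → inside lo hi p s ≡ 1
inside-yes a b rewrite ≤⇒≤ᵇ-true a | ≤⇒≤ᵇ-true b = refl

inside-no : ∀ {lo hi p s} → ¬ (lo ≤ p × s ≤ hi) → inside lo hi p s ≡ 0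
inside-no {lo} {hi} {p} {s} ne with lo ≤? p | s ≤? hi
... | yes a | yes b = ⊥-elim (ne (a , b))
... | no a | _ rewrite >⇒≤ᵇ-false (≰⇒> a) = refl
... | yes a | no b rewrite ≤⇒≤ᵇ-true a | >⇒≤ᵇ-false (≰⇒> b) = refl

inside≤1 : ∀ lo hi p s → inside lo hi p s ≤ 1
inside≤1 lo hi p s with (lo ≤ᵇ p) ∧ (s ≤ᵇ hi)
... | true = ≤-refl
... | false = z≤n

inside-mono : ∀ {lo hi lo′ hi′} p s → lo′ ≤ lo → hi ≤ hi′ → inside lo hi p s ≤ inside lo′ hi′ p s
inside-mono {lo} {hi} p s x y with lo ≤? p | s ≤? hi
... | yes a | yes b rewrite inside-yes a b | inside-yes (≤-trans x a) (≤-trans b y) = ≤-refl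
... | no a | _ rewrite inside-no {lo} {hi} {p} {s} (λ x → a (proj₁ x)) = z≤n
... | yes a | no b rewrite inside-no {lo} {hi} {p} {s} (λ x → b (proj₂ x)) = z≤n

countInside≤length : ∀ qs lo hi → countInside qs lo hi ≤ length qs
countInside≤length [] lo hi = z≤n
countInside≤length ((p , s) ∷ qs) lo hi = +-mono-≤ (inside≤1 lo hi p s) (countInside≤length qs lo hi)

countInside-mono : ∀ qs {lo hi lo′ hi′} → lo′ ≤ lo → hi ≤ hi′ → countInside qs lo hi ≤ countInside qs lo′ hi′
countInside-mono [] x y = z≤n
countInside-mono ((p , s) ∷ qs) x y = +-mono-≤ (inside-mono p s x y) (countInside-mono qs x y)

countInside-mono-< : ∀ qs {lo hi lo′ hi′ p s} → lo′ ≤ lo → hi ≤ hi′ → (p , s) ∈ qs → lo′ ≤ p → s ≤ hi′ →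
  ¬ (lo ≤ p × s ≤ hi) → countInside qs lo hi < countInside qs lo′ hi′
countInside-mono-< ((p , s) ∷ qs) x y (here refl) a b ne
  rewrite inside-no ne | inside-yes a b = s≤s (countInside-mono qs x y)
countInside-mono-< ((p₀ , s₀) ∷ qs) x y (there i) a b ne =
  +-mono-≤-< (inside-mono p₀ s₀ x y) (countInside-mono-< qs x y i a b ne)

closed-or-escaping : ∀ qs lo hi →
  Closed qs lo hi ⊎ Σ ℕ λ p → Σ ℕ λ s → (p , s) ∈ qs × Overlaps lo hi p s × ¬ (lo ≤ p × s ≤ hi)
closed-or-escaping [] lo hi = inj₁ (λ p s ())
closed-or-escaping ((p , s) ∷ qs) lo hi with closed-or-escaping qs lo hi
... | inj₂ (p′ , s′ , i , o , ne) = inj₂ (p′ , s′ , there i , o , ne)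
... | inj₁ cl with p ≤? hi | lo ≤? s | lo ≤? p | s ≤? hi
... | yes a | yes b | yes c | yes d = inj₁ (extend (λ _ → c , d))
  where
  extend : (Overlaps lo hi p s → lo ≤ p × s ≤ hi) → Closed ((p , s) ∷ qs) lo hi
  extend f p′ s′ (here refl) o = f o
  extend f p′ s′ (there i) o = cl p′ s′ i o
... | yes a | yes b | no c | _ = inj₂ (p , s , here refl , (a , b) , (λ x → c (proj₁ x)))
... | yes a | yes b | yes c | no d = inj₂ (p , s , here refl , (a , b) , (λ x → d (proj₂ x)))
... | no a | _ | _ | _ = inj₁ extend
  where
  extend : Closed ((p , s) ∷ qs) lo hi
  extend p′ s′ (here refl) o = ⊥-elim (a (proj₁ o))
  extend p′ s′ (there i) o = cl p′ s′ i o
... | yes a | no b | _ | _ = inj₁ extend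
  where
  extend : Closed ((p , s) ∷ qs) lo hi
  extend p′ s′ (here refl) o = ⊥-elim (b (proj₂ o))
  extend p′ s′ (there i) o = cl p′ s′ i o

×-η : ∀ (z : ℕ × ℕ) {a b} → proj₁ z ≡ a → proj₂ z ≡ b → z ≡ (a , b)
×-η (x , y) refl refl = refl

module Components (ps : Paths) where

  G : ℕ × ℕ → ℕ × ℕ
  G = grow ps

  grow-⊇ : ∀ lo hi → proj₁ (G (lo , hi)) ≤ lo × hi ≤ proj₂ (G (lo , hi))
  grow-⊇ lo hi with g1 , g2 , _ ← growStep-spec lo hi ps (lo , hi) = g1 , g2

  grow-least : ∀ lo hi L H → Closed ps L H → L ≤ lo → hi ≤ H → L ≤ proj₁ (G (lo , hi)) × proj₂ (G (lo , hi)) ≤ H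
  grow-least lo hi L H cl x y with _ , _ , _ , g4 ← growStep-spec lo hi ps (lo , hi) =
    g4 L H x y (λ p s i o → cl p s i (≤-trans (proj₁ o) y , ≤-trans x (proj₂ o)))

  grow-absorbs : ∀ lo hi p s → (p , s) ∈ ps → Overlaps lo hi p s → proj₁ (G (lo , hi)) ≤ p × s ≤ proj₂ (G (lo , hi))
  grow-absorbs lo hi with _ , _ , g3 , _ ← growStep-spec lo hi ps (lo , hi) = g3

  grow-closed : ∀ lo hi → Closed ps lo hi → G (lo , hi) ≡ (lo , hi)
  grow-closed lo hi cl = ×-η (G (lo , hi))
    (≤-antisym (proj₁ (grow-⊇ lo hi)) (proj₁ (grow-least lo hi lo hi cl ≤-refl ≤-refl)))
    (≤-antisym (proj₂ (grow-least lo hi lo hi cl ≤-refl ≤-refl)) (proj₂ (grow-⊇ lo hi)))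

  iter-closed : ∀ i lo hi → Closed ps lo hi → iter i G (lo , hi) ≡ (lo , hi)
  iter-closed zero lo hi cl = refl
  iter-closed (suc i) lo hi cl rewrite grow-closed lo hi cl = iter-closed i lo hi cl

  iter-⊇ : ∀ i lo hi → proj₁ (iter i G (lo , hi)) ≤ lo × hi ≤ proj₂ (iter i G (lo , hi))
  iter-⊇ zero lo hi = ≤-refl , ≤-refl
  iter-⊇ (suc i) lo hi with grow-⊇ lo hi | iter-⊇ i (proj₁ (G (lo , hi))) (proj₂ (G (lo , hi)))
  ... | a , b | c , d = ≤-trans c a , ≤-trans b d

  iter-least : ∀ i lo hi L H → Closed ps L H → L ≤ lo → hi ≤ H →
    L ≤ proj₁ (iter i G (lo , hi)) × proj₂ (iter i G (lo , hi)) ≤ H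
  iter-least zero lo hi L H cl x y = x , y
  iter-least (suc i) lo hi L H cl x y with a , b ← grow-least lo hi L H cl x y =
    iter-least i (proj₁ (G (lo , hi))) (proj₂ (G (lo , hi))) L H cl a b

  iter-closed-or-counts : ∀ i lo hi →
    let (l , h) = iter i G (lo , hi) in Closed ps l h ⊎ i + countInside ps lo hi ≤ countInside ps l h
  iter-closed-or-counts zero lo hi = inj₂ ≤-refl
  iter-closed-or-counts (suc i) lo hi with closed-or-escaping ps lo hi
  ... | inj₁ cl rewrite grow-closed lo hi cl | iter-closed i lo hi cl = inj₁ cl
  ... | inj₂ (p , s , i∈ , o , ne) with iter-closed-or-counts i (proj₁ (G (lo , hi))) (proj₂ (G (lo , hi)))
  ...   | inj₁ cl = inj₁ cl
  ...   | inj₂ le = inj₂ (≤-trans (subst (_≤ i + countInside ps (proj₁ (G (lo , hi))) (proj₂ (G (lo , hi))))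
                                          (+-suc i (countInside ps lo hi)) (+-monoʳ-≤ i more)) le)
    where
    more : countInside ps lo hi < countInside ps (proj₁ (G (lo , hi))) (proj₂ (G (lo , hi)))
    more = countInside-mono-< ps (proj₁ (grow-⊇ lo hi)) (proj₂ (grow-⊇ lo hi)) i∈
             (proj₁ (grow-absorbs lo hi p s i∈ o)) (proj₂ (grow-absorbs lo hi p s i∈ o)) ne

  -- abstract only to keep the normal forms of later goals small
  abstract
    cmpLo : ℕ → ℕ
    cmpLo v = proj₁ (component ps v)

    cmpHi : ℕ → ℕ
    cmpHi v = proj₂ (component ps v)

    cmpLo-def : ∀ v → cmpLo v ≡ proj₁ (component ps v)
    cmpLo-def v = refl

    cmpHi-def : ∀ v → cmpHi v ≡ proj₂ (component ps v)
    cmpHi-def v = refl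

    component-closed : ∀ v → Closed ps (cmpLo v) (cmpHi v)
    component-closed v with iter-closed-or-counts (suc (length ps)) v v
    ... | inj₁ c = c
    ... | inj₂ le = ⊥-elim (<⇒≱ (s≤s (m≤m+n (length ps) (countInside ps v v))) (≤-trans le (countInside≤length ps _ _)))

    component-∋ : ∀ v → cmpLo v ≤ v × v ≤ cmpHi v
    component-∋ v = iter-⊇ (suc (length ps)) v v

    component-least : ∀ v L H → Closed ps L H → L ≤ v → v ≤ H → L ≤ cmpLo v × cmpHi v ≤ H
    component-least v L H c x y = iter-least (suc (length ps)) v v L H c x y

  cmpLo≤cmpHi : ∀ v → cmpLo v ≤ cmpHi v
  cmpLo≤cmpHi v = ≤-trans (proj₁ (component-∋ v)) (proj₂ (component-∋ v))

  -- cutting the component of v at a closed interval [a, b] not containing v would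
  -- leave a smaller closed interval around v
  closed-subinterval-∌ : ∀ v {a b} → Closed ps a b → a ≤ b → cmpLo v ≤ a → b ≤ cmpHi v → v < a ⊎ b < v → ⊥
  closed-subinterval-∌ v {suc a′} {b} cab ab la bh (inj₁ va) =
    <⇒≱ (s≤s ≤-refl)
      (≤-trans ab (≤-trans bh (proj₂ (component-least v (cmpLo v) a′ left (proj₁ (component-∋ v)) (s≤s⁻¹ va)))))
    where
    left : Closed ps (cmpLo v) a′
    left p s i (pa , ls) with component-closed v p s i (≤-trans pa (≤-trans (n≤1+n a′) (≤-trans ab bh)) , ls)
    ... | lp , sh with s ≤? a′
    ...   | yes sa = lp , sa
    ...   | no sa = ⊥-elim (<⇒≱ (proj₁ (cab p s i (≤-trans pa (≤-trans (n≤1+n a′) ab) , ≰⇒> sa))) pa)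
  closed-subinterval-∌ v {zero} cab ab la bh (inj₁ ())
  closed-subinterval-∌ v {a} {b} cab ab la bh (inj₂ bv) =
    <⇒≱ (s≤s ≤-refl) (≤-trans (proj₁ (component-least v (suc b) (cmpHi v) right bv (proj₂ (component-∋ v)))) (≤-trans la ab))
    where
    right : Closed ps (suc b) (cmpHi v)
    right p s i (ph , bs) with component-closed v p s i (ph , ≤-trans la (≤-trans ab (≤-trans (n≤1+n b) bs)))
    ... | lp , sh with suc b ≤? p
    ...   | yes bp = bp , sh
    ...   | no bp = ⊥-elim (<⇒≱ bs (proj₂ (cab p s i (s≤s⁻¹ (≰⇒> bp) , ≤-trans ab (≤-trans (n≤1+n b) bs)))))

  component-cong : ∀ v u → cmpLo v ≤ u → u ≤ cmpHi v → cmpLo u ≡ cmpLo v × cmpHi u ≡ cmpHi v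
  component-cong v u lu uh with component-least u (cmpLo v) (cmpHi v) (component-closed v) lu uh
  ... | a , b with cmpLo u ≤? v | v ≤? cmpHi u
  ...   | yes c | yes d with e , f ← component-least v (cmpLo u) (cmpHi u) (component-closed u) c d =
    ≤-antisym e a , ≤-antisym b f
  component-cong v u lu uh | a , b | no c | _ =
    ⊥-elim (closed-subinterval-∌ v (component-closed u) (cmpLo≤cmpHi u) a b (inj₁ (≰⇒> c)))
  component-cong v u lu uh | a , b | yes c | no d =
    ⊥-elim (closed-subinterval-∌ v (component-closed u) (cmpLo≤cmpHi u) a b (inj₂ (≰⇒> d)))

  components-equal-or-apart : ∀ u v → (cmpLo u ≡ cmpLo v × cmpHi u ≡ cmpHi v) ⊎ cmpHi u < cmpLo v ⊎ cmpHi v < cmpLo u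
  components-equal-or-apart u v with cmpHi u <? cmpLo v | cmpHi v <? cmpLo u
  ... | yes x | _ = inj₂ (inj₁ x)
  ... | no x | yes y = inj₂ (inj₂ y)
  ... | no x | no y with cmpLo u ≤? cmpLo v
  ...   | yes z with a , b ← component-cong u (cmpLo v) z (≮⇒≥ x)
                 | c , d ← component-cong v (cmpLo v) ≤-refl (cmpLo≤cmpHi v) =
    inj₁ (trans (sym a) c , trans (sym b) d)
  ...   | no z with a , b ← component-cong v (cmpLo u) (<⇒≤ (≰⇒> z)) (≮⇒≥ y)
                | c , d ← component-cong u (cmpLo u) ≤-refl (cmpLo≤cmpHi u) =
    inj₁ (trans (sym c) a , trans (sym d) b)

  path⊆component : ∀ p s → (p , s) ∈ ps → p ≤ s → s ≤ cmpHi p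
  path⊆component p s i p≤s =
    proj₂ (component-closed p p s i (proj₂ (component-∋ p) , ≤-trans (proj₁ (component-∋ p)) p≤s))

  component⊆ : ∀ (σ : List ℕ) → (∀ p s x → (p , s) ∈ ps → p ≤ x → x ≤ s → memb x σ ≡ true) →
    ∀ v x → memb v σ ≡ true → cmpLo v ≤ x → x ≤ cmpHi v → memb x σ ≡ true
  component⊆ σ covers v x mv lx xh with bool-split (memb x σ)
  ... | inj₁ t = t
  ... | inj₂ f with <-cmp v x
  ...   | tri≈ _ refl _ = mv
  ...   | tri< vx _ _ = ⊥-elim (closed-subinterval-∌ v untouched ≤-refl lx xh (inj₁ vx))
    where
    untouched : Closed ps x x
    untouched p s i (px , xs) = ⊥-elim (true≢false (trans (sym (covers p s x i px xs)) f))
  ...   | tri> _ _ xv = ⊥-elim (closed-subinterval-∌ v untouched ≤-refl lx xh (inj₂ xv))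
    where
    untouched : Closed ps x x
    untouched p s i (px , xs) = ⊥-elim (true≢false (trans (sym (covers p s x i px xs)) f))

  component-within : ∀ n → (∀ p s → (p , s) ∈ ps → 1 ≤ p × s ≤ n) →
    ∀ v → 1 ≤ v → v ≤ n → 1 ≤ cmpLo v × cmpHi v ≤ n
  component-within n bounded v a b = component-least v 1 n (λ p s i _ → bounded p s i) a b

-- The parking reflection

reflectPref-component : ∀ n qs v →
  reflectPref n qs v ≡ (suc n ∸ proj₂ (component qs v)) + (v ∸ proj₁ (component qs v))
reflectPref-component n qs v with component qs v
... | (lo , hi) = refl

ValidPaths : ℕ → Paths → Set
ValidPaths n ps = ∀ p s → (p , s) ∈ ps → 1 ≤ p × p ≤ s × s ≤ n

module Reflection (n : ℕ) (ps : Paths) (valid : ValidPaths n ps) where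
  open Components ps public

  N : ℕ
  N = suc n

  -- v ↦ (n + 1 - hi) + (v - lo): the component [lo, hi] of v is moved to its mirror position
  reflected : ℕ → ℕ
  reflected v = (N ∸ cmpHi v) + (v ∸ cmpLo v)

  reflectPref≡reflected : ∀ v → reflectPref n ps v ≡ reflected v
  reflectPref≡reflected v = trans (reflectPref-component n ps v)
    (cong₂ (λ a b → (N ∸ a) + (v ∸ b)) (sym (cmpHi-def v)) (sym (cmpLo-def v)))

  component-inLot : ∀ v → 1 ≤ v → v ≤ n → 1 ≤ cmpLo v × cmpHi v ≤ n
  component-inLot = component-within n (λ p s i → proj₁ (valid p s i) , proj₂ (proj₂ (valid p s i)))

  cmpHi≤N : ∀ {v} → 1 ≤ v → v ≤ n → cmpHi v ≤ N
  cmpHi≤N 1v vn = m≤n⇒m≤1+n (proj₂ (component-inLot _ 1v vn))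

  reflected-≥ : ∀ v → N ∸ cmpHi v ≤ reflected v
  reflected-≥ v = m≤m+n _ _

  reflected-≤ : ∀ v → 1 ≤ v → v ≤ n → reflected v ≤ N ∸ cmpLo v
  reflected-≤ v 1v vn = ∸-+-≤ N (proj₁ (component-∋ v)) (proj₂ (component-∋ v)) (cmpHi≤N 1v vn)

  reflected-inLot : ∀ v → 1 ≤ v → v ≤ n → 1 ≤ reflected v × reflected v ≤ n
  reflected-inLot v 1v vn =
    ≤-trans (1≤suc-∸ (proj₂ (component-inLot v 1v vn))) (reflected-≥ v) ,
    ≤-trans (reflected-≤ v 1v vn) (∸-monoʳ-≤ N (proj₁ (component-inLot v 1v vn)))

  reflected-in-component : ∀ v w → cmpLo v ≤ w → w ≤ cmpHi v → reflected w ≡ (N ∸ cmpHi v) + (w ∸ cmpLo v)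
  reflected-in-component v w a b with e1 , e2 ← component-cong v w a b rewrite e1 | e2 = refl

  reflected-along-path : ∀ p s w → (p , s) ∈ ps → p ≤ w → w ≤ s → reflected w ≡ reflected p + (w ∸ p)
  reflected-along-path p s w i pw ws with _ , p≤s , _ ← valid p s i =
    trans (reflected-in-component p w (≤-trans (proj₁ (component-∋ p)) pw) (≤-trans ws (path⊆component p s i p≤s)))
      (trans (cong ((N ∸ cmpHi p) +_) (∸-split (proj₁ (component-∋ p)) pw)) (sym (+-assoc (N ∸ cmpHi p) _ (w ∸ p))))

  reflected-injective : ∀ u v → 1 ≤ u → u ≤ n → 1 ≤ v → v ≤ n → reflected u ≡ reflected v → u ≡ v
  reflected-injective u v 1u un 1v vn e with components-equal-or-apart u v
  ... | inj₁ (e1 , e2) = ∸-cancelʳ-≡ (subst (_≤ u) e1 (proj₁ (component-∋ u))) (proj₁ (component-∋ v))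
        (+-cancelˡ-≡ (N ∸ cmpHi v) (u ∸ cmpLo v) (v ∸ cmpLo v)
          (trans (sym (reflected-in-component v u (subst (_≤ u) e1 (proj₁ (component-∋ u)))
                                                 (subst (u ≤_) e2 (proj₂ (component-∋ u))))) e))
  ... | inj₂ (inj₁ lt) = ⊥-elim (<⇒≱ (<-≤-trans (∸-monoʳ-< lt (m≤n⇒m≤1+n (≤-trans (proj₁ (component-∋ v)) vn)))
                                                (reflected-≥ u))
                           (≤-trans (≤-reflexive e) (reflected-≤ v 1v vn)))
  ... | inj₂ (inj₂ lt) = ⊥-elim (<⇒≱ (<-≤-trans (∸-monoʳ-< lt (m≤n⇒m≤1+n (≤-trans (proj₁ (component-∋ u)) un)))
                                                (reflected-≥ v))
                           (≤-trans (≤-reflexive (sym e)) (reflected-≤ u 1u un)))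

  reflectPath : ℕ × ℕ → ℕ × ℕ
  reflectPath (p , s) = (reflected p , reflected s)

  reflectedPaths : Paths
  reflectedPaths = map reflectPath ps

  module R = Components reflectedPaths

  reflectedPaths⁻ : ∀ {p′ s′} → (p′ , s′) ∈ reflectedPaths →
    Σ ℕ λ p → Σ ℕ λ s → (p , s) ∈ ps × p′ ≡ reflected p × s′ ≡ reflected s
  reflectedPaths⁻ i with (p , s) , j , e ← ∈-map⁻ reflectPath i = p , s , j , cong proj₁ e , cong proj₂ e

  mirror-closed : ∀ v → 1 ≤ v → v ≤ n → Closed reflectedPaths (N ∸ cmpHi v) (N ∸ cmpLo v)
  mirror-closed v 1v vn p′ s′ i (o1 , o2) with reflectedPaths⁻ i
  ... | p , s , j , refl , refl with 1p , p≤s , sn ← valid p s j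
      with components-equal-or-apart p v | component-cong p s (≤-trans (proj₁ (component-∋ p)) p≤s) (path⊆component p s j p≤s)
  ... | inj₁ (e1 , e2) | f1 , f2 =
          subst (λ z → N ∸ z ≤ reflected p) e2 (reflected-≥ p) ,
          ≤-trans (reflected-≤ s (≤-trans 1p p≤s) sn) (≤-reflexive (cong (N ∸_) (trans f1 e1)))
  ... | inj₂ (inj₁ lt) | _ =
          ⊥-elim (<⇒≱ (<-≤-trans (∸-monoʳ-< lt (m≤n⇒m≤1+n (≤-trans (proj₁ (component-∋ v)) vn))) (reflected-≥ p)) o1)
  ... | inj₂ (inj₂ lt) | f1 , f2 = ⊥-elim (<⇒≱ (≤-<-trans (reflected-≤ s (≤-trans 1p p≤s) sn)
          (subst (λ z → N ∸ z < N ∸ cmpHi v) (sym f1)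
            (∸-monoʳ-< lt (m≤n⇒m≤1+n (≤-trans (proj₁ (component-∋ p)) (≤-trans p≤s sn)))))) o2)

  pullback-closed : ∀ v {α β} → cmpLo v + β ≤ cmpHi v →
    Closed reflectedPaths ((N ∸ cmpHi v) + α) ((N ∸ cmpHi v) + β) → Closed ps (cmpLo v + α) (cmpLo v + β)
  pullback-closed v {α} {β} Lβ≤H closed′ p s i (pb , as)
    with Lp , sH ← component-closed v p s i (≤-trans pb Lβ≤H , ≤-trans (m≤m+n (cmpLo v) α) as) = Lα≤p , s≤Lβ
    where
    L = cmpLo v
    c = N ∸ cmpHi v
    ps≤ : p ≤ s
    ps≤ = proj₁ (proj₂ (valid p s i))
    Ls : L ≤ s
    Ls = ≤-trans Lp ps≤
    Tp : reflected p ≡ c + (p ∸ L)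
    Tp = reflected-in-component v p Lp (≤-trans ps≤ sH)
    Ts : reflected s ≡ c + (s ∸ L)
    Ts = reflected-in-component v s Ls sH
    inside′ : c + α ≤ reflected p × reflected s ≤ c + β
    inside′ = closed′ (reflected p) (reflected s) (∈-map⁺ reflectPath i)
      (subst (_≤ c + β) (sym Tp) (+-monoʳ-≤ c (≤-trans (∸-monoˡ-≤ L pb) (≤-reflexive (m+n∸m≡n L β)))) ,
       subst (c + α ≤_) (sym Ts) (+-monoʳ-≤ c (+-≤⇒≤-∸ as)))
    Lα≤p : L + α ≤ p
    Lα≤p = subst (L + α ≤_) (m+[n∸m]≡n Lp) (+-monoʳ-≤ L (+-cancelˡ-≤ c _ _ (subst (c + α ≤_) Tp (proj₁ inside′))))
    s≤Lβ : s ≤ L + β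
    s≤Lβ = ∸-≤⇒≤-+ Ls (+-cancelˡ-≤ c _ _ (subst (_≤ c + β) Ts (proj₂ inside′)))

  reflected-component-⊆ : ∀ v → 1 ≤ v → v ≤ n →
    N ∸ cmpHi v ≤ R.cmpLo (reflected v) × R.cmpHi (reflected v) ≤ N ∸ cmpLo v
  reflected-component-⊆ v 1v vn =
    R.component-least (reflected v) _ _ (mirror-closed v 1v vn) (reflected-≥ v) (reflected-≤ v 1v vn)

  -- the pullback of the reflected component is a closed interval around v
  reflected-component-⊇ : ∀ v → 1 ≤ v → v ≤ n →
    R.cmpLo (reflected v) ≤ N ∸ cmpHi v × N ∸ cmpLo v ≤ R.cmpHi (reflected v)
  reflected-component-⊇ v 1v vn = a≤c , N∸L≤b
    where
    L = cmpLo v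
    H = cmpHi v
    c = N ∸ H
    a = R.cmpLo (reflected v)
    b = R.cmpHi (reflected v)
    Lv : L ≤ v
    Lv = proj₁ (component-∋ v)
    vH : v ≤ H
    vH = proj₂ (component-∋ v)
    aT : a ≤ reflected v
    aT = proj₁ (R.component-∋ (reflected v))
    Tb : reflected v ≤ b
    Tb = proj₂ (R.component-∋ (reflected v))
    ca : c ≤ a
    ca = proj₁ (reflected-component-⊆ v 1v vn)
    α = a ∸ c
    β = b ∸ c
    a≡ : a ≡ c + α
    a≡ = sym (m+[n∸m]≡n ca)
    b≡ : b ≡ c + β
    b≡ = sym (m+[n∸m]≡n (≤-trans ca (≤-trans aT Tb)))
    N∸L≡ : N ∸ L ≡ c + (H ∸ L)
    N∸L≡ = trans (∸-split (≤-trans Lv vH) (cmpHi≤N 1v vn)) (+-comm (H ∸ L) c)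
    Lβ≤H : L + β ≤ H
    Lβ≤H = subst (L + β ≤_) (m+[n∸m]≡n (≤-trans Lv vH))
             (+-monoʳ-≤ L (+-cancelˡ-≤ c _ _ (subst₂ _≤_ b≡ N∸L≡ (proj₂ (reflected-component-⊆ v 1v vn)))))
    Tv : reflected v ≡ c + (v ∸ L)
    Tv = reflected-in-component v v Lv vH
    around-v : L + α ≤ L × H ≤ L + β
    around-v = component-least v (L + α) (L + β)
      (pullback-closed v Lβ≤H (subst₂ (Closed reflectedPaths) a≡ b≡ (R.component-closed (reflected v))))
      (subst (L + α ≤_) (m+[n∸m]≡n Lv) (+-monoʳ-≤ L (+-cancelˡ-≤ c _ _ (subst₂ _≤_ a≡ Tv aT))))
      (∸-≤⇒≤-+ Lv (+-cancelˡ-≤ c _ _ (subst₂ _≤_ Tv b≡ Tb)))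
    a≤c : a ≤ c
    a≤c = subst₂ _≤_ (sym a≡) (+-identityʳ c)
            (+-monoʳ-≤ c (+-cancelˡ-≤ L α 0 (subst (L + α ≤_) (sym (+-identityʳ L)) (proj₁ around-v))))
    N∸L≤b : N ∸ L ≤ b
    N∸L≤b = subst₂ _≤_ (sym N∸L≡) (sym b≡)
              (+-monoʳ-≤ c (subst (H ∸ L ≤_) (m+n∸m≡n L β) (∸-monoˡ-≤ L (proj₂ around-v))))

  reflected-component : ∀ v → 1 ≤ v → v ≤ n →
    R.cmpLo (reflected v) ≡ N ∸ cmpHi v × R.cmpHi (reflected v) ≡ N ∸ cmpLo v
  reflected-component v 1v vn with ⊆₁ , ⊆₂ ← reflected-component-⊆ v 1v vn | ⊇₁ , ⊇₂ ← reflected-component-⊇ v 1v vn =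
    ≤-antisym ⊇₁ ⊆₁ , ≤-antisym ⊆₂ ⊇₂

  reflected-involutive : ∀ v → 1 ≤ v → v ≤ n → (N ∸ R.cmpHi (reflected v)) + (reflected v ∸ R.cmpLo (reflected v)) ≡ v
  reflected-involutive v 1v vn with e1 , e2 ← reflected-component v 1v vn rewrite e1 | e2 = begin
    (N ∸ (N ∸ cmpLo v)) + (reflected v ∸ (N ∸ cmpHi v))
      ≡⟨ cong₂ _+_ (m∸[m∸n]≡n (m≤n⇒m≤1+n (≤-trans (proj₁ (component-∋ v)) vn)))
                   (m+n∸m≡n (N ∸ cmpHi v) (v ∸ cmpLo v)) ⟩
    cmpLo v + (v ∸ cmpLo v)
      ≡⟨ m+[n∸m]≡n (proj₁ (component-∋ v)) ⟩
    v ∎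
    where open ≡-Reasoning

-- A car preferring q and parking at u in the classical process is "backward-type" when
-- its displacement u - q is at most k; this is the type it receives under Ξ.
classicalType : ℕ → ℕ → ℕ → Bool
classicalType k q u = u ≤ᵇ q + k

naplesType : ℕ → ℕ → Bool
naplesType a v = v ≤ᵇ a

SameOcc : ℕ → List ℕ → List ℕ → Set
SameOcc n σ S = ∀ v → 1 ≤ v → v ≤ n → memb v σ ≡ memb v S

MirrorOcc : ℕ → List ℕ → List ℕ → Set
MirrorOcc n σ S = ∀ v → 1 ≤ v → v ≤ n → memb v σ ≡ memb (suc n ∸ v) S

OccInLot : ℕ → List ℕ → Set
OccInLot n occ = ∀ w → memb w occ ≡ true → 1 ≤ w × w ≤ n

OccInLot-∷ : ∀ {n u occ} → 1 ≤ u → u ≤ n → OccInLot n occ → OccInLot n (u ∷ occ)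
OccInLot-∷ {u = u} 1u un inLot w m with ∨-true⁻ {u ≡ᵇ w} m
... | inj₁ t rewrite ≡ᵇ-true⇒≡ {u} {w} t = 1u , un
... | inj₂ t = inLot w t

module _ (n : ℕ) where

  classical-run-paths : ∀ occ xs {ss} → run (classicalStep n) occ xs ≡ just ss → ∀ (F : List ℕ) →
    (∀ w → memb w occ ≡ true → memb w F ≡ true) → (∀ w → w ∈ ss → memb w F ≡ true) →
    ∀ p s → (p , s) ∈ zip xs ss → 1 ≤ p × p ≤ s × s ≤ n × (∀ w → p ≤ w → w ≤ s → memb w F ≡ true)
  classical-run-paths occ [] e F occ⊆F ss⊆F p s ()
  classical-run-paths occ (a ∷ xs) e F occ⊆F ss⊆F p s i with classicalStep n occ a in eq
  ... | just u with run (classicalStep n) (u ∷ occ) xs in eq′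
  ... | just ss′ with refl ← e with i
  ...   | here refl with 1a , au , un , uf , occd ← classicalStep-sound n occ a eq = 1a , au , un , covered
    where
    covered : ∀ w → a ≤ w → w ≤ u → memb w F ≡ true
    covered w aw wu with m≤n⇒m<n∨m≡n wu
    ... | inj₁ lt = occ⊆F w (occd w aw lt)
    ... | inj₂ refl = ss⊆F w (here refl)
  ...   | there j = classical-run-paths (u ∷ occ) xs eq′ F occ′⊆F (λ w k → ss⊆F w (there k)) p s j
    where
    occ′⊆F : ∀ w → memb w (u ∷ occ) ≡ true → memb w F ≡ true
    occ′⊆F w m with ∨-true⁻ {u ≡ᵇ w} m
    ... | inj₁ x rewrite ≡ᵇ-true⇒≡ {u} {w} x = ss⊆F w (here refl)
    ... | inj₂ x = occ⊆F w x

  classical-run-inLot : ∀ occ xs {ss} → run (classicalStep n) occ xs ≡ just ss → ∀ w → w ∈ ss → 1 ≤ w × w ≤ n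
  classical-run-inLot occ [] refl w ()
  classical-run-inLot occ (a ∷ xs) e w i with classicalStep n occ a in eq
  ... | just u with run (classicalStep n) (u ∷ occ) xs in eq′
  ... | just ss′ with refl ← e with i
  ...   | here refl with 1a , au , un , _ ← classicalStep-sound n occ a eq = ≤-trans 1a au , un
  ...   | there j = classical-run-inLot (u ∷ occ) xs eq′ w j

  module ReflectedParking (x σ : List ℕ) (x-inLot : InLot n x) (park : parkC n x ≡ just σ) where

    paths : Paths
    paths = zip x σ

    path-facts : ∀ p s → (p , s) ∈ paths → 1 ≤ p × p ≤ s × s ≤ n × (∀ w → p ≤ w → w ≤ s → memb w σ ≡ true)
    path-facts = classical-run-paths [] x park σ (λ w ()) (λ w i → ∈⇒memb-true i)

    valid : ValidPaths n paths
    valid p s i with a , b , c , _ ← path-facts p s i = a , b , c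

    open Reflection n paths valid public

    reflected-step : ∀ occ a u → (a , u) ∈ paths → OccInLot n occ →
      ClassicalSpot n occ a u → ClassicalSpot n (map reflected occ) (reflected a) (reflected u)
    reflected-step occ a u i occ-inLot (1a , au , un , uf , occd) =
      proj₁ (reflected-inLot a 1a an) , Ta≤Tu , proj₂ (reflected-inLot u 1u un) , free , occupied-between
      where
      an = ≤-trans au un
      1u = ≤-trans 1a au
      Tu≡ : reflected u ≡ reflected a + (u ∸ a)
      Tu≡ = reflected-along-path a u u i au ≤-refl
      Ta≤Tu = subst (reflected a ≤_) (sym Tu≡) (m≤m+n (reflected a) (u ∸ a))
      free : memb (reflected u) (map reflected occ) ≡ false
      free with bool-split (memb (reflected u) (map reflected occ))
      ... | inj₂ f = f
      ... | inj₁ t with w , mw , e ← memb-map⁻ reflected occ t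
                   with 1w , wn ← occ-inLot w mw
                   with refl ← reflected-injective w u 1w wn 1u un e = ⊥-elim (true≢false (trans (sym mw) uf))
      occupied-between : ∀ y → reflected a ≤ y → y < reflected u → memb y (map reflected occ) ≡ true
      occupied-between y ay yu = subst (λ z → memb z (map reflected occ) ≡ true) Tw≡ (memb-map⁺ reflected {w} occ (occd w aw wu))
        where
        j = y ∸ reflected a
        w = a + j
        y≡ : y ≡ reflected a + j
        y≡ = sym (m+[n∸m]≡n ay)
        aw : a ≤ w
        aw = m≤m+n a j
        wu : w < u
        wu = subst (w <_) (m+[n∸m]≡n au) (+-monoʳ-< a (+-cancelˡ-< (reflected a) j (u ∸ a) (subst₂ _<_ y≡ Tu≡ yu)))
        Tw≡ : reflected w ≡ y
        Tw≡ = trans (reflected-along-path a u w i aw (<⇒≤ wu)) (trans (cong (reflected a +_) (m+n∸m≡n a j)) (sym y≡))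

    reflected-run : ∀ occ xs {ss} → run (classicalStep n) occ xs ≡ just ss → (∀ p s → (p , s) ∈ zip xs ss → (p , s) ∈ paths) →
      OccInLot n occ → run (classicalStep n) (map reflected occ) (map reflected xs) ≡ just (map reflected ss)
    reflected-run occ [] refl sub occ-inLot = refl
    reflected-run occ (a ∷ xs) e sub occ-inLot with classicalStep n occ a in eq
    ... | just u with run (classicalStep n) (u ∷ occ) xs in eq′
    ... | just ss′ with refl ← e with spot@(1a , au , un , _) ← classicalStep-sound n occ a eq =
      run-∷ (classicalStep n) (map reflected occ) (reflected a) (map reflected xs)
        (classicalStep-complete n _ _ (reflected-step occ a u (sub a u (here refl)) occ-inLot spot))
        (reflected-run (u ∷ occ) xs eq′ (λ p s i → sub p s (there i)) (OccInLot-∷ {occ = occ} (≤-trans 1a au) un occ-inLot))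

    reflected-park : parkC n (map reflected x) ≡ just (map reflected σ)
    reflected-park = reflected-run [] x park (λ p s i → i) (λ w ())

    Φ-reflected : Φ n x ≡ just (map reflected x)
    Φ-reflected rewrite park = cong just (map-cong reflectPref≡reflected x)

    σ-inLot : ∀ w → w ∈ σ → 1 ≤ w × w ≤ n
    σ-inLot = classical-run-inLot [] x park

    mirror-point : ℕ → ℕ
    mirror-point w = cmpLo w + (cmpHi w ∸ w)

    mirror-point-∈ : ∀ w → cmpLo w ≤ mirror-point w × mirror-point w ≤ cmpHi w
    mirror-point-∈ w = m≤m+n (cmpLo w) (cmpHi w ∸ w) ,
      subst (mirror-point w ≤_) (m+[n∸m]≡n (proj₂ (component-∋ w))) (+-monoˡ-≤ (cmpHi w ∸ w) (proj₁ (component-∋ w)))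

    -- occupied components are full, so the reflected occupancy is the mirror image
    reflected-occupancy : MirrorOcc n (map reflected σ) σ
    reflected-occupancy v 1v vn = bool-ext to from
      where
      covers : ∀ p s w → (p , s) ∈ paths → p ≤ w → w ≤ s → memb w σ ≡ true
      covers p s w i = proj₂ (proj₂ (proj₂ (path-facts p s i))) w
      to : memb v (map reflected σ) ≡ true → memb (N ∸ v) σ ≡ true
      to t with w , mw , e ← memb-map⁻ reflected σ t with 1w , wn ← σ-inLot w (memb-true⇒∈ mw) =
        subst (λ z → memb z σ ≡ true)
          (sym (trans (cong (N ∸_) (sym e))
                      (mirror-in-interval (proj₁ (component-∋ w)) (proj₂ (component-∋ w)) (cmpHi≤N 1w wn))))
          (component⊆ σ covers w _ mw (proj₁ (mirror-point-∈ w)) (proj₂ (mirror-point-∈ w)))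
      from : memb (N ∸ v) σ ≡ true → memb v (map reflected σ) ≡ true
      from t with 1w , wn ← σ-inLot (N ∸ v) (memb-true⇒∈ t) =
        subst (λ z → memb z (map reflected σ) ≡ true) T≡v
          (memb-map⁺ reflected {mirror-point w} σ
            (component⊆ σ covers w (mirror-point w) t (proj₁ (mirror-point-∈ w)) (proj₂ (mirror-point-∈ w))))
        where
        w = N ∸ v
        T≡v : reflected (mirror-point w) ≡ v
        T≡v = trans (reflected-in-component w (mirror-point w) (proj₁ (mirror-point-∈ w)) (proj₂ (mirror-point-∈ w)))
                (trans (reflect-mirror-in-interval (proj₁ (component-∋ w)) (proj₂ (component-∋ w)) (cmpHi≤N 1w wn))
                  (m∸[m∸n]≡n (m≤n⇒m≤1+n vn)))

    -- a reflected traverse path is a translate of the original one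
    reflected-types : ∀ k → zipWith (classicalType k) (map reflected x) (map reflected σ) ≡ zipWith (classicalType k) x σ
    reflected-types k = zipWith-map-invariant (classicalType k) reflected x σ same-type
      where
      same-type : ∀ p s → (p , s) ∈ zip x σ → classicalType k (reflected p) (reflected s) ≡ classicalType k p s
      same-type p s i with _ , p≤s , _ ← valid p s i = begin
        reflected s ≤ᵇ reflected p + k        ≡⟨ cong (_≤ᵇ reflected p + k) (reflected-along-path p s s i p≤s ≤-refl) ⟩
        reflected p + (s ∸ p) ≤ᵇ reflected p + k ≡⟨ ≤ᵇ-+-cancelˡ (reflected p) (s ∸ p) k ⟩
        s ∸ p ≤ᵇ k                            ≡⟨ sym (≤ᵇ-+-cancelˡ p (s ∸ p) k) ⟩
        p + (s ∸ p) ≤ᵇ p + k                  ≡⟨ cong (_≤ᵇ p + k) (m+[n∸m]≡n p≤s) ⟩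
        s ≤ᵇ p + k                            ∎
        where open ≡-Reasoning

    reflected-inLot* : ∀ xs → InLot n xs → InLot n (map reflected xs)
    reflected-inLot* [] [] = []
    reflected-inLot* (a ∷ xs) ((p , q) ∷ r) = reflected-inLot a p q ∷ reflected-inLot* xs r

    reflected-back : ∀ xs → InLot n xs → map (reflectPref n reflectedPaths) (map reflected xs) ≡ xs
    reflected-back [] [] = refl
    reflected-back (a ∷ xs) ((p , q) ∷ r) = cong₂ _∷_
      (trans (reflectPref-component n reflectedPaths (reflected a))
        (trans (cong₂ (λ u w → (N ∸ u) + (reflected a ∸ w)) (sym (R.cmpHi-def (reflected a))) (sym (R.cmpLo-def (reflected a))))
          (reflected-involutive a p q)))
      (reflected-back xs r)

    Φ-involutive : Φ n (map reflected x) ≡ just x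
    Φ-involutive rewrite reflected-park | zip-map reflected reflected x σ = cong just (reflected-back x x-inLot)

  record ReflectionFacts (k : ℕ) (x σ : List ℕ) : Set where
    constructor reflectionFacts
    field
      y : List ℕ
      Φx : Φ n x ≡ just y
      y-inLot : InLot n y
      length-y : length y ≡ length x
      σ′ : List ℕ
      park-y : parkC n y ≡ just σ′
      types-y : zipWith (classicalType k) y σ′ ≡ zipWith (classicalType k) x σ
      occupancy-y : MirrorOcc n σ′ σ
      Φy : Φ n y ≡ just x

  reflection-facts : ∀ k x σ → InLot n x → parkC n x ≡ just σ → ReflectionFacts k x σ
  reflection-facts k x σ x-inLot park = record
    { y = map reflected x ; Φx = Φ-reflected ; y-inLot = reflected-inLot* x x-inLot ; length-y = length-map reflected x
    ; σ′ = map reflected σ ; park-y = reflected-park ; types-y = reflected-types k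
    ; occupancy-y = reflected-occupancy ; Φy = Φ-involutive }
    where open ReflectedParking x σ x-inLot park

-- Blocks and Ξ

Blocks : Set
Blocks = List (Bool × List ℕ)

consBlock : ℕ × Bool → Blocks → Blocks
consBlock (a , t) [] = (t , a ∷ []) ∷ []
consBlock (a , t) ((t′ , b) ∷ rest) = if sameType t t′ then (t , a ∷ b) ∷ rest else (t , a ∷ []) ∷ (t′ , b) ∷ rest

groupTypes-∷ : ∀ a t xs → groupTypes ((a , t) ∷ xs) ≡ consBlock (a , t) (groupTypes xs)
groupTypes-∷ a t xs with groupTypes xs
... | [] = refl
... | _ ∷ _ = refl

snocBlock : Blocks → ℕ × Bool → Blocks
snocBlock [] (a , t) = (t , a ∷ []) ∷ []
snocBlock ((t′ , b) ∷ []) (a , t) = if sameType t′ t then (t′ , b ∷ʳ a) ∷ [] else (t′ , b) ∷ (t , a ∷ []) ∷ []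
snocBlock (x ∷ y ∷ rest) z = x ∷ snocBlock (y ∷ rest) z

sameType⇒≡ : ∀ {t t′} → sameType t t′ ≡ true → t′ ≡ t
sameType⇒≡ {true} {true} e = refl
sameType⇒≡ {false} {false} e = refl

sameType-false⇒not : ∀ {t t′} → sameType t t′ ≡ false → t′ ≡ not t
sameType-false⇒not {true} {false} e = refl
sameType-false⇒not {false} {true} e = refl

snocBlock-head : ∀ t₁ b₁ rest z → Σ (List ℕ) λ b₁′ → Σ Blocks λ rest′ →
  snocBlock ((t₁ , b₁) ∷ rest) z ≡ (t₁ , b₁′) ∷ rest′
  × (∀ a₀ → snocBlock ((t₁ , a₀ ∷ b₁) ∷ rest) z ≡ (t₁ , a₀ ∷ b₁′) ∷ rest′)
snocBlock-head t₁ b₁ [] (a , t) with sameType t₁ t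
... | true = b₁ ∷ʳ a , [] , refl , (λ a₀ → refl)
... | false = b₁ , (t , a ∷ []) ∷ [] , refl , (λ a₀ → refl)
snocBlock-head t₁ b₁ (y ∷ r) z = b₁ , snocBlock (y ∷ r) z , refl , (λ a₀ → refl)

consBlock-snocBlock : ∀ a₀ t₀ bs z → consBlock (a₀ , t₀) (snocBlock bs z) ≡ snocBlock (consBlock (a₀ , t₀) bs) z
consBlock-snocBlock a₀ t₀ [] (a , t) with sameType t₀ t
... | true = refl
... | false = refl
consBlock-snocBlock a₀ t₀ ((t₁ , b₁) ∷ rest) z with b₁′ , rest′ , e₁ , e₂ ← snocBlock-head t₁ b₁ rest z
  rewrite e₁ with sameType t₀ t₁ in st
... | true rewrite sameType⇒≡ {t₀} {t₁} st = sym (e₂ a₀)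
... | false = cong ((t₀ , a₀ ∷ []) ∷_) (sym e₁)

groupTypes-∷ʳ : ∀ τ z → groupTypes (τ ∷ʳ z) ≡ snocBlock (groupTypes τ) z
groupTypes-∷ʳ [] (a , t) = refl
groupTypes-∷ʳ ((a₀ , t₀) ∷ τ) z = begin
  groupTypes ((a₀ , t₀) ∷ τ ∷ʳ z)                ≡⟨ groupTypes-∷ a₀ t₀ (τ ∷ʳ z) ⟩
  consBlock (a₀ , t₀) (groupTypes (τ ∷ʳ z))      ≡⟨ cong (consBlock (a₀ , t₀)) (groupTypes-∷ʳ τ z) ⟩
  consBlock (a₀ , t₀) (snocBlock (groupTypes τ) z) ≡⟨ consBlock-snocBlock a₀ t₀ (groupTypes τ) z ⟩
  snocBlock (consBlock (a₀ , t₀) (groupTypes τ)) z ≡⟨ cong (λ q → snocBlock q z) (sym (groupTypes-∷ a₀ t₀ τ)) ⟩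
  snocBlock (groupTypes ((a₀ , t₀) ∷ τ)) z        ∎
  where open ≡-Reasoning

-- the type of the last car (false, i.e. forward, for no cars at all)
lastType : List Bool → Bool
lastType [] = false
lastType (t ∷ []) = t
lastType (_ ∷ y ∷ r) = lastType (y ∷ r)

lastType-∷ʳ : ∀ xs t → lastType (xs ∷ʳ t) ≡ t
lastType-∷ʳ [] t = refl
lastType-∷ʳ (x ∷ []) t = refl
lastType-∷ʳ (x ∷ y ∷ xs) t = lastType-∷ʳ (y ∷ xs) t

lastBlockType : Blocks → Bool
lastBlockType bs = lastType (map proj₁ bs)

snocBlock-nonempty : ∀ bs z → snocBlock bs z ≢ []
snocBlock-nonempty [] z ()
snocBlock-nonempty ((t′ , b) ∷ []) (a , t) e with sameType t′ t
snocBlock-nonempty ((t′ , b) ∷ []) (a , t) () | true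
snocBlock-nonempty ((t′ , b) ∷ []) (a , t) () | false
snocBlock-nonempty (x ∷ y ∷ r) z ()

lastBlockType-snocBlock : ∀ bs a t → lastBlockType (snocBlock bs (a , t)) ≡ t
lastBlockType-snocBlock [] a t = refl
lastBlockType-snocBlock ((t′ , b) ∷ []) a t with sameType t′ t in st
... | true = sym (sameType⇒≡ {t′} {t} st)
... | false = refl
lastBlockType-snocBlock (x ∷ y ∷ r) a t with snocBlock (y ∷ r) (a , t) in eq | lastBlockType-snocBlock (y ∷ r) a t
... | [] | _ = ⊥-elim (snocBlock-nonempty (y ∷ r) (a , t) eq)
... | b ∷ bs | e = e

lastBlockType-groupTypes : ∀ τ → lastBlockType (groupTypes τ) ≡ lastType (map proj₂ τ)
lastBlockType-groupTypes τ = go (reverseView τ)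
  where
  go : ∀ {τ} → Reverse τ → lastBlockType (groupTypes τ) ≡ lastType (map proj₂ τ)
  go [] = refl
  go (τ ∶ _ ∶ʳ (a , t)) rewrite groupTypes-∷ʳ τ (a , t) | lastBlockType-snocBlock (groupTypes τ) a t
                                | map-++ proj₂ τ ((a , t) ∷ []) = sym (lastType-∷ʳ (map proj₂ τ) t)

module _ (n k : ℕ) where

  νCar : Bool → ℕ → ℕ
  νCar true p = suc n ∸ p
  νCar false p = p ∸ k

  ν-++ : ∀ t b c → ν n k (t , b ++ c) ≡ ν n k (t , b) ++ ν n k (t , c)
  ν-++ true b c = map-++ (λ p → suc n ∸ p) b c
  ν-++ false b c = map-++ (λ p → p ∸ k) b c

  ν-single : ∀ t a → ν n k (t , a ∷ []) ≡ νCar t a ∷ []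
  ν-single true a = refl
  ν-single false a = refl

  ΞStep-++ : ∀ z t b c → ΞStep n k z (t , b ++ c) ≡ mapMaybe (_++ ν n k (t , c)) (ΞStep n k z (t , b))
  ΞStep-++ nothing t b c = refl
  ΞStep-++ (just x) t b c rewrite ν-++ t b c with Φ n x
  ... | nothing = refl
  ... | just y = cong just (sym (++-assoc y (ν n k (t , b)) (ν n k (t , c))))

  foldl-ΞStep-snocBlock : ∀ z bs a t → bs ≢ [] →
    foldl (ΞStep n k) z (snocBlock bs (a , t)) ≡
      (if sameType (lastBlockType bs) t then mapMaybe (_∷ʳ νCar t a) (foldl (ΞStep n k) z bs)
       else ΞStep n k (foldl (ΞStep n k) z bs) (t , a ∷ []))
  foldl-ΞStep-snocBlock z [] a t ne = ⊥-elim (ne refl)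
  foldl-ΞStep-snocBlock z ((t′ , b) ∷ []) a t ne with sameType t′ t in st
  ... | true with refl ← sameType⇒≡ {t′} {t} st =
    trans (ΞStep-++ z t b (a ∷ [])) (cong (λ q → mapMaybe (_++ q) (ΞStep n k z (t , b))) (ν-single t a))
  ... | false = refl
  foldl-ΞStep-snocBlock z (x ∷ y ∷ r) a t ne = foldl-ΞStep-snocBlock (ΞStep n k z x) (y ∷ r) a t (λ ())

  ΞTagged : List (ℕ × Bool) → Maybe (List ℕ)
  ΞTagged τ = foldl (ΞStep n k) (just []) (groupTypes τ)

  ΞTagged-∷ʳ : ∀ τ a t → ΞTagged (τ ∷ʳ (a , t)) ≡
    (if sameType (lastType (map proj₂ τ)) t then mapMaybe (_∷ʳ νCar t a) (ΞTagged τ)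
     else ΞStep n k (ΞTagged τ) (t , a ∷ []))
  ΞTagged-∷ʳ τ a t rewrite groupTypes-∷ʳ τ (a , t) | sym (lastBlockType-groupTypes τ) with groupTypes τ
  ... | [] with t
  ...   | true = refl
  ...   | false = refl
  ΞTagged-∷ʳ τ a t | b ∷ bs = foldl-ΞStep-snocBlock (just []) (b ∷ bs) a t (λ ())

-- One car: Naples versus classical

-- the condition defining B(m, n; k) for a car preferring a, given the occupancy P
Contained : ℕ → List ℕ → ℕ → Set
Contained k P a = a ≤ k → ∃ λ v → 1 ≤ v × v ≤ a × memb v P ≡ false

module _ (n k : ℕ) where

  N : ℕ
  N = suc n

  N∸-involutive : ∀ {v} → v ≤ n → N ∸ (N ∸ v) ≡ v
  N∸-involutive vn = m∸[m∸n]≡n (m≤n⇒m≤1+n vn)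

  N∸-inLot : ∀ {v} → 1 ≤ v → v ≤ n → 1 ≤ N ∸ v × N ∸ v ≤ n
  N∸-inLot {v} 1v vn = subst (_≤ N ∸ v) (m+n∸n≡m 1 n) (∸-monoʳ-≤ N vn) , ∸-monoʳ-≤ N 1v

  SameOcc-∷ʳ : ∀ {σ S} w → SameOcc n σ S → SameOcc n (σ ∷ʳ w) (S ∷ʳ w)
  SameOcc-∷ʳ {σ} {S} w same v 1v vn rewrite memb-∷ʳ v σ w | memb-∷ʳ v S w | same v 1v vn = refl

  MirrorOcc-∷ʳ : ∀ {σ S w} → 1 ≤ w → w ≤ n → MirrorOcc n σ S → MirrorOcc n (σ ∷ʳ (N ∸ w)) (S ∷ʳ w)
  MirrorOcc-∷ʳ {σ} {S} {w} 1w wn mirror v 1v vn rewrite memb-∷ʳ v σ (N ∸ w) | memb-∷ʳ (N ∸ v) S w | mirror v 1v vn =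
    cong (memb (N ∸ v) S ∨_) (bool-ext to from)
    where
    to : (N ∸ w ≡ᵇ v) ≡ true → (w ≡ᵇ N ∸ v) ≡ true
    to e rewrite sym (≡ᵇ-true⇒≡ {N ∸ w} {v} e) | N∸-involutive wn = ≡ᵇ-refl w
    from : (w ≡ᵇ N ∸ v) ≡ true → (N ∸ w ≡ᵇ v) ≡ true
    from e rewrite ≡ᵇ-true⇒≡ {w} {N ∸ v} e | N∸-involutive vn = ≡ᵇ-refl v

  mirror-SameOcc : ∀ {σ σ′ S} → SameOcc n σ S → MirrorOcc n σ′ σ → MirrorOcc n σ′ S
  mirror-SameOcc same mirror v 1v vn = trans (mirror v 1v vn) (same (N ∸ v) (proj₁ (N∸-inLot 1v vn)) (proj₂ (N∸-inLot 1v vn)))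

  mirror-MirrorOcc : ∀ {σ σ′ S} → MirrorOcc n σ S → MirrorOcc n σ′ σ → SameOcc n σ′ S
  mirror-MirrorOcc {S = S} mirror mirror′ v 1v vn =
    trans (mirror′ v 1v vn) (trans (mirror (N ∸ v) (proj₁ (N∸-inLot 1v vn)) (proj₂ (N∸-inLot 1v vn)))
                                   (cong (λ z → memb z S) (N∸-involutive vn)))

  -- A forward-type Naples car preferring a behaves like a classical car preferring a - k:
  -- the k vertices before a are full, so the classical car meets the same occupied run.
  naples-forward⇒classical : ∀ {O P a w} → naplesStep k n P a ≡ just w → (w ≤ᵇ a) ≡ false → SameOcc n O P →
    Contained k P a → k < a × classicalStep n O (a ∸ k) ≡ just w × classicalType k (a ∸ k) w ≡ false
  naples-forward⇒classical {O} {P} {a} {w} step forward same contained with naplesStep-sound k n P a step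
  ... | 1a , an , inj₁ (refl , _) = ⊥-elim (true≢false (trans (sym (≤⇒≤ᵇ-true (≤-refl {a}))) forward))
  ... | 1a , an , inj₂ (inj₁ (_ , wa , _)) = ⊥-elim (true≢false (trans (sym (≤⇒≤ᵇ-true (<⇒≤ wa))) forward))
  ... | 1a , an , inj₂ (inj₂ (a-occ , full , aw , (wn , wf , occd))) =
    k<a , classicalStep-complete n O q (1q , ≤-trans (m∸n≤m a k) (<⇒≤ aw) , wn , w-free , occupied-between) ,
    trans (cong (w ≤ᵇ_) q+k≡a) forward
    where
    k<a : k < a
    k<a with a ≤? k
    ... | no a≰k = ≰⇒> a≰k
    ... | yes a≤k with v , 1v , va , vf ← contained a≤k with m≤n⇒m<n∨m≡n va
    ...   | inj₂ refl = ⊥-elim (true≢false (trans (sym a-occ) vf))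
    ...   | inj₁ v<a = ⊥-elim (true≢false (trans (sym (full v 1v v<a (≤-trans a≤k (m≤n+m k v)))) vf))
    q = a ∸ k
    q+k≡a : q + k ≡ a
    q+k≡a = m∸n+n≡m (<⇒≤ k<a)
    1q : 1 ≤ q
    1q = subst (_≤ a ∸ k) (m+n∸n≡m 1 k) (∸-monoˡ-≤ k k<a)
    w-free : memb w O ≡ false
    w-free = trans (same w (≤-trans 1a (<⇒≤ aw)) wn) wf
    occupied-between : ∀ y → q ≤ y → y < w → memb y O ≡ true
    occupied-between y qy yw = trans (same y (≤-trans 1q qy) (≤-trans (<⇒≤ yw) wn)) occupied-in-P
      where
      occupied-in-P : memb y P ≡ true
      occupied-in-P with <-cmp y a
      ... | tri< ya _ _ = full y (≤-trans 1q qy) ya (subst (_≤ y + k) q+k≡a (+-monoˡ-≤ k qy))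
      ... | tri≈ _ refl _ = a-occ
      ... | tri> _ _ ay = occd y ay yw

  naples-backward⇒classical : ∀ {O P a w} → naplesStep k n P a ≡ just w → (w ≤ᵇ a) ≡ true → MirrorOcc n O P →
    classicalStep n O (N ∸ a) ≡ just (N ∸ w) × classicalType k (N ∸ a) (N ∸ w) ≡ true
  naples-backward⇒classical {O} {P} {a} {w} step backward mirror with naplesStep-sound k n P a step
  ... | 1a , an , inj₂ (inj₂ (_ , _ , aw , _)) = ⊥-elim (<⇒≱ aw (≤ᵇ-true⇒≤ backward))
  ... | 1a , an , inj₁ (refl , af) =
    classicalStep-complete n O (N ∸ a) (1q , ≤-refl , qn , free , (λ y qy yq → ⊥-elim (<⇒≱ yq qy))) ,
    ≤⇒≤ᵇ-true (m≤m+n (N ∸ a) k)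
    where
    1q = proj₁ (N∸-inLot 1a an)
    qn = proj₂ (N∸-inLot 1a an)
    free : memb (N ∸ a) O ≡ false
    free = trans (mirror (N ∸ a) 1q qn) (trans (cong (λ z → memb z P) (N∸-involutive an)) af)
  ... | 1a , an , inj₂ (inj₁ (a-occ , wa , (1w , awk , wf , occd))) =
    classicalStep-complete n O (N ∸ a) (1q , ∸-monoʳ-≤ N (<⇒≤ wa) , un , free , occupied-between) ,
    ≤⇒≤ᵇ-true (mirror-displacement (<⇒≤ wa) (m≤n⇒m≤1+n an) awk)
    where
    1q = proj₁ (N∸-inLot 1a an)
    wn = ≤-trans (<⇒≤ wa) an
    un = proj₂ (N∸-inLot 1w wn)
    free : memb (N ∸ w) O ≡ false
    free = trans (mirror (N ∸ w) (proj₁ (N∸-inLot 1w wn)) un) (trans (cong (λ z → memb z P) (N∸-involutive wn)) wf)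
    occupied-between : ∀ y → N ∸ a ≤ y → y < N ∸ w → memb y O ≡ true
    occupied-between y qy yu = trans (mirror y (≤-trans 1q qy) (≤-trans (<⇒≤ yu) un)) occupied-in-P
      where
      N∸y≤a : N ∸ y ≤ a
      N∸y≤a = subst (N ∸ y ≤_) (N∸-involutive an) (∸-monoʳ-≤ N qy)
      w<N∸y : w < N ∸ y
      w<N∸y = subst (_< N ∸ y) (N∸-involutive wn) (∸-monoʳ-< yu (m∸n≤m N w))
      occupied-in-P : memb (N ∸ y) P ≡ true
      occupied-in-P with m≤n⇒m<n∨m≡n N∸y≤a
      ... | inj₂ e = subst (λ z → memb z P ≡ true) (sym e) a-occ
      ... | inj₁ lt = occd (N ∸ y) w<N∸y lt

  classical-forward⇒naples : ∀ {O P q u} → classicalStep n O q ≡ just u → classicalType k q u ≡ false → SameOcc n O P →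
    naplesStep k n P (q + k) ≡ just u × (u ≤ᵇ q + k) ≡ false × Contained k P (q + k)
  classical-forward⇒naples {O} {P} {q} {u} step forward same with 1q , qu , un , uf , occd ← classicalStep-sound n O q step =
    naplesStep-forward k n P a 1a an a-occ full au (un , trans (sym (same u (≤-trans 1q qu) un)) uf , occupied-between) ,
    forward , (λ ak → ⊥-elim (<⇒≱ (+-monoˡ-≤ k 1q) ak))
    where
    a = q + k
    au : a < u
    au = ≤ᵇ-false⇒> forward
    an = ≤-trans (<⇒≤ au) un
    1a = ≤-trans 1q (m≤m+n q k)
    P≡O : ∀ y → 1 ≤ y → y < u → memb y P ≡ memb y O
    P≡O y 1y yu = sym (same y 1y (≤-trans (<⇒≤ yu) un))
    a-occ : memb a P ≡ true
    a-occ = trans (P≡O a 1a au) (occd a (m≤m+n q k) au)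
    full : BackFull k P a
    full y 1y ya ay = trans (P≡O y 1y (<-trans ya au)) (occd y (+-cancelʳ-≤ k q y ay) (<-trans ya au))
    occupied-between : ∀ y → a < y → y < u → memb y P ≡ true
    occupied-between y ay yu = trans (P≡O y (≤-trans 1a (<⇒≤ ay)) yu) (occd y (≤-trans (m≤m+n q k) (<⇒≤ ay)) yu)

  classical-backward⇒naples : ∀ {O P q u} → classicalStep n O q ≡ just u → classicalType k q u ≡ true → MirrorOcc n O P →
    naplesStep k n P (N ∸ q) ≡ just (N ∸ u) × ((N ∸ u) ≤ᵇ (N ∸ q)) ≡ true × Contained k P (N ∸ q)
  classical-backward⇒naples {O} {P} {q} {u} step backward mirror with 1q , qu , un , uf , occd ← classicalStep-sound n O q step =
    naples , ≤⇒≤ᵇ-true (∸-monoʳ-≤ N qu) , (λ _ → w , 1w , ∸-monoʳ-≤ N qu , w-free)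
    where
    a = N ∸ q
    w = N ∸ u
    1u = ≤-trans 1q qu
    qn = ≤-trans qu un
    1a = proj₁ (N∸-inLot 1q qn)
    an = proj₂ (N∸-inLot 1q qn)
    1w = proj₁ (N∸-inLot 1u un)
    w-free : memb w P ≡ false
    w-free = trans (sym (mirror u 1u un)) uf
    naples : naplesStep k n P a ≡ just w
    naples with m≤n⇒m<n∨m≡n qu
    ... | inj₂ refl = naplesStep-preferred k n P a 1a an (trans (sym (mirror q 1q qn)) uf)
    ... | inj₁ q<u = naplesStep-back k n P a 1a an a-occ (∸-monoʳ-< q<u (m≤n⇒m≤1+n un))
                       (1w , mirror-displacement qu (m≤n⇒m≤1+n un) (≤ᵇ-true⇒≤ backward) , w-free , occupied-between)
      where
      a-occ : memb a P ≡ true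
      a-occ = trans (sym (mirror q 1q qn)) (occd q ≤-refl q<u)
      occupied-between : ∀ y → w < y → y < a → memb y P ≡ true
      occupied-between y wy ya = subst (λ z → memb z P ≡ true) (N∸-involutive yn)
        (trans (sym (mirror (N ∸ y) (≤-trans 1q (<⇒≤ q<N∸y)) (≤-trans (<⇒≤ N∸y<u) un))) (occd (N ∸ y) (<⇒≤ q<N∸y) N∸y<u))
        where
        yn = ≤-trans (<⇒≤ ya) an
        q<N∸y : q < N ∸ y
        q<N∸y = subst (_< N ∸ y) (N∸-involutive qn) (∸-monoʳ-< ya (m∸n≤m N q))
        N∸y<u : N ∸ y < u
        N∸y<u = subst (N ∸ y <_) (N∸-involutive un) (∸-monoʳ-< wy (m≤n⇒m≤1+n yn))

-- The bijection

module Main (n k : ℕ) where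

  Occ : Bool → List ℕ → List ℕ → Set
  Occ true = MirrorOcc n
  Occ false = SameOcc n

  Occ-occupied : ∀ t {σ S} → Occ t σ S → Occ t (occupied σ) (occupied S)
  Occ-occupied true {σ} {S} mirror v 1v vn = trans (memb-occupied v σ) (trans (mirror v 1v vn) (sym (memb-occupied (suc n ∸ v) S)))
  Occ-occupied false {σ} {S} same v 1v vn = trans (memb-occupied v σ) (trans (same v 1v vn) (sym (memb-occupied v S)))

  Occ-flip : ∀ t {σ σ′ S} → Occ t σ S → MirrorOcc n σ′ σ → Occ (not t) σ′ S
  Occ-flip true {σ} {σ′} {S} = mirror-MirrorOcc n k {σ} {σ′} {S}
  Occ-flip false {σ} {σ′} {S} = mirror-SameOcc n k {σ} {σ′} {S}

  Occ-keep : ∀ t t′ σ S → sameType t t′ ≡ true → Occ t σ S → Occ t′ σ S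
  Occ-keep t t′ σ S same = subst (λ b → Occ b σ S) (sym (sameType⇒≡ {t} {t′} same))

  Occ-switch : ∀ t t′ σ σ′ S → sameType t t′ ≡ false → Occ t σ S → MirrorOcc n σ′ σ → Occ t′ σ′ S
  Occ-switch t t′ σ σ′ S switch occ mirror =
    subst (λ b → Occ b σ′ S) (sym (sameType-false⇒not {t} {t′} switch)) (Occ-flip t {σ} {σ′} {S} occ mirror)

  ∉⇒Contained : ∀ {S a} → (a ≤ k → ∃ λ v → 1 ≤ v × v ≤ a × v ∉ S) → Contained k (occupied S) a
  ∉⇒Contained {S} c ak with v , 1v , va , v∉ ← c ak = v , 1v , va , trans (memb-occupied v S) (∉⇒memb-false v∉)

  naples⇒classical : ∀ {σ S a w} → naplesStep k n (occupied S) a ≡ just w → Occ (naplesType a w) σ S →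
    Contained k (occupied S) a →
    Σ ℕ λ u → classicalStep n (occupied σ) (νCar n k (naplesType a w) a) ≡ just u
      × classicalType k (νCar n k (naplesType a w) a) u ≡ naplesType a w
      × Occ (naplesType a w) (σ ∷ʳ u) (S ∷ʳ w) × (naplesType a w ≡ false → k < a)
  naples⇒classical {σ} {S} {a} {w} step occ contained with naplesType a w in t
  ... | true with cstep , ctype ← naples-backward⇒classical n k step t (Occ-occupied true {σ} {S} occ)
             with 1w , wn ← naplesStep-inLot k n _ a step =
    suc n ∸ w , cstep , ctype , MirrorOcc-∷ʳ n k {σ} {S} 1w wn occ , (λ ())
  ... | false with k<a , cstep , ctype ← naples-forward⇒classical n k step t (Occ-occupied false {σ} {S} occ) contained =
    w , cstep , ctype , SameOcc-∷ʳ n k {σ} {S} w occ , (λ _ → k<a)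

  Contained⇒∉ : ∀ {S a} → Contained k (occupied S) a → a ≤ k → ∃ λ v → 1 ≤ v × v ≤ a × v ∉ S
  Contained⇒∉ {S} c ak with v , 1v , va , vf ← c ak = v , 1v , va , memb-false⇒∉ (trans (sym (memb-occupied v S)) vf)

  classical⇒naples : ∀ {σ S q u} → classicalStep n (occupied σ) q ≡ just u → Occ (classicalType k q u) σ S →
    Σ ℕ λ a → Σ ℕ λ w → naplesStep k n (occupied S) a ≡ just w × naplesType a w ≡ classicalType k q u
      × νCar n k (classicalType k q u) a ≡ q × Contained k (occupied S) a
  classical⇒naples {σ} {S} {q} {u} step occ with classicalType k q u in t
  ... | true with nstep , ntype , contained ← classical-backward⇒naples n k step t (Occ-occupied true {σ} {S} occ)
             with 1q , qu , un , _ ← classicalStep-sound n _ q step =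
    suc n ∸ q , suc n ∸ u , nstep , ntype , N∸-involutive n k (≤-trans qu un) , contained
  ... | false with nstep , ntype , contained ← classical-forward⇒naples n k step t (Occ-occupied false {σ} {S} occ) =
    q + k , u , nstep , ntype , m+n∸n≡m q k , contained

  naplesTypes : List ℕ → List ℕ → List Bool
  naplesTypes = zipWith naplesType

  classicalTypes : List ℕ → List ℕ → List Bool
  classicalTypes = zipWith (classicalType k)

  ContainedPrefixes : List ℕ → Set
  ContainedPrefixes f =
    ∀ g a h → f ≡ g ++ (a ∷ h) → a ≤ k → ∀ occ → parkK k n g ≡ just occ → ∃ λ v → 1 ≤ v × v ≤ a × v ∉ occ

  -- B(m, n; k) without the length condition
  InB : List ℕ → Set
  InB f = InLot n f × (∃ λ S → parkK k n f ≡ just S) × ContainedPrefixes f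

  ContainedPrefixes-init : ∀ f a → ContainedPrefixes (f ∷ʳ a) → ContainedPrefixes f
  ContainedPrefixes-init f a c g a′ h e = c g a′ (h ∷ʳ a) (trans (cong (_∷ʳ a) e) (++-assoc g (a′ ∷ h) (a ∷ [])))

  ContainedPrefixes-last : ∀ f a {S} → ContainedPrefixes (f ∷ʳ a) → parkK k n f ≡ just S →
    a ≤ k → ∃ λ v → 1 ≤ v × v ≤ a × v ∉ S
  ContainedPrefixes-last f a c e ak = c f a [] refl ak _ e

  ContainedPrefixes-∷ʳ : ∀ f a → ContainedPrefixes f →
    (a ≤ k → ∀ S → parkK k n f ≡ just S → ∃ λ v → 1 ≤ v × v ≤ a × v ∉ S) → ContainedPrefixes (f ∷ʳ a)
  ContainedPrefixes-∷ʳ f a c last g a′ h e with reverseView h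
  ... | [] with refl , refl ← ∷ʳ-injective f g e = last
  ... | h′ ∶ _ ∶ʳ z with e′ , refl ← ∷ʳ-injective f (g ++ a′ ∷ h′) (trans e (sym (++-assoc g (a′ ∷ h′) (z ∷ [])))) =
    c g a′ h′ e′

  InB-init : ∀ f a → InB (f ∷ʳ a) → InB f
  InB-init f a (inLot , (S′ , park) , c) with S , _ , park′ , _ ← run-∷ʳ⁻ (naplesStep k n) f a park =
    ++⁻ˡ f inLot , (S , park′) , ContainedPrefixes-init f a c

  record Parked (f x : List ℕ) : Set where
    field
      S : List ℕ
      parkK≡ : parkK k n f ≡ just S
      σ : List ℕ
      parkC≡ : parkC n x ≡ just σ
      x-inLot : InLot n x
      length≡ : length x ≡ length f
      types≡ : naplesTypes f S ≡ classicalTypes x σ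

    lastT : Bool
    lastT = lastType (naplesTypes f S)

  record Matched (f x : List ℕ) : Set where
    field
      parked : Parked f x
    open Parked parked public
    field
      occupancy : Occ lastT σ S

  naplesTypes-∷ʳ : ∀ f {S a w} → parkK k n f ≡ just S → naplesTypes (f ∷ʳ a) (S ∷ʳ w) ≡ naplesTypes f S ∷ʳ naplesType a w
  naplesTypes-∷ʳ f {S} {a} {w} park = zipWith-∷ʳ naplesType f S a w (sym (run-length (naplesStep k n) [] f park))

  classicalTypes-∷ʳ : ∀ x {σ q u} → parkC n x ≡ just σ →
    classicalTypes (x ∷ʳ q) (σ ∷ʳ u) ≡ classicalTypes x σ ∷ʳ classicalType k q u
  classicalTypes-∷ʳ x {σ} {q} {u} park = zipWith-∷ʳ (classicalType k) x σ q u (sym (run-length (classicalStep n) [] x park))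

  parked-∷ʳ : ∀ {f x a q w u} (p : Parked f x) → naplesStep k n (occupied (Parked.S p)) a ≡ just w →
    classicalStep n (occupied (Parked.σ p)) q ≡ just u → naplesType a w ≡ classicalType k q u → Parked (f ∷ʳ a) (x ∷ʳ q)
  parked-∷ʳ {f} {x} {a} {q} {w} {u} p nstep cstep same-type with 1q , qu , un , _ ← classicalStep-sound n _ q cstep = record
    { S = S ∷ʳ w
    ; parkK≡ = run-∷ʳ⁺ (naplesStep k n) f parkK≡ nstep
    ; σ = σ ∷ʳ u
    ; parkC≡ = run-∷ʳ⁺ (classicalStep n) x parkC≡ cstep
    ; x-inLot = ++⁺ x-inLot ((1q , ≤-trans qu un) ∷ [])
    ; length≡ = trans (length-++ x) (trans (cong (_+ 1) length≡) (sym (length-++ f)))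
    ; types≡ = trans (naplesTypes-∷ʳ f parkK≡)
                 (trans (cong₂ _∷ʳ_ types≡ same-type) (sym (classicalTypes-∷ʳ x parkC≡)))
    }
    where open Parked p

  parked-reflected : ∀ {f x} (p : Parked f x) (r : ReflectionFacts n k x (Parked.σ p)) → Parked f (ReflectionFacts.y r)
  parked-reflected p r = record
    { S = S ; parkK≡ = parkK≡ ; σ = σ′ ; parkC≡ = park-y ; x-inLot = y-inLot
    ; length≡ = trans length-y length≡ ; types≡ = trans types≡ (sym types-y) }
    where
    open Parked p
    open ReflectionFacts r

  matched-∷ʳ : ∀ {f y a w} (p : Parked f y) → naplesStep k n (occupied (Parked.S p)) a ≡ just w →
    Occ (naplesType a w) (Parked.σ p) (Parked.S p) → Contained k (occupied (Parked.S p)) a →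
    Σ (Matched (f ∷ʳ a) (y ∷ʳ νCar n k (naplesType a w) a)) λ m →
      Matched.S m ≡ Parked.S p ∷ʳ w × (naplesType a w ≡ false → k < a)
  matched-∷ʳ {f} {y} {a} {w} p nstep occ contained
    with u , cstep , ctype , occ′ , forward ← naples⇒classical {Parked.σ p} {Parked.S p} nstep occ contained =
    record { parked = p′ ; occupancy = subst (λ t → Occ t (Parked.σ p ∷ʳ u) (Parked.S p ∷ʳ w)) (sym last≡) occ′ } ,
    refl , forward
    where
    p′ : Parked (f ∷ʳ a) (y ∷ʳ νCar n k (naplesType a w) a)
    p′ = parked-∷ʳ p nstep cstep (sym ctype)
    last≡ : Parked.lastT p′ ≡ naplesType a w
    last≡ = trans (cong lastType (naplesTypes-∷ʳ f (Parked.parkK≡ p))) (lastType-∷ʳ (naplesTypes f (Parked.S p)) _)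

  -- Ξ does not use its first argument m
  Ξ′ : List ℕ → Maybe (List ℕ)
  Ξ′ = Ξ 0 n k

  tagged : List ℕ → List ℕ → List (ℕ × Bool)
  tagged = zipWith (λ a v → (a , naplesType a v))

  Ξ′-tagged : ∀ f {S} → parkK k n f ≡ just S → Ξ′ f ≡ ΞTagged n k (tagged f S)
  Ξ′-tagged f e rewrite e = refl

  types-tagged : ∀ f S → map proj₂ (tagged f S) ≡ naplesTypes f S
  types-tagged [] S = refl
  types-tagged (a ∷ f) [] = refl
  types-tagged (a ∷ f) (v ∷ S) = cong (naplesType a v ∷_) (types-tagged f S)

  Ξ′-∷ʳ : ∀ f {S a w x} → parkK k n f ≡ just S → naplesStep k n (occupied S) a ≡ just w → Ξ′ f ≡ just x →
    let t = naplesType a w in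
    Ξ′ (f ∷ʳ a) ≡ (if sameType (lastType (naplesTypes f S)) t then just (x ∷ʳ νCar n k t a)
                   else ΞStep n k (just x) (t , a ∷ []))
  Ξ′-∷ʳ f {S} {a} {w} {x} park nstep Ξf = begin
    Ξ′ (f ∷ʳ a)
      ≡⟨ Ξ′-tagged (f ∷ʳ a) (run-∷ʳ⁺ (naplesStep k n) f park nstep) ⟩
    ΞTagged n k (tagged (f ∷ʳ a) (S ∷ʳ w))
      ≡⟨ cong (ΞTagged n k) (zipWith-∷ʳ _ f S a w (sym (run-length (naplesStep k n) [] f park))) ⟩
    ΞTagged n k (tagged f S ∷ʳ (a , t))
      ≡⟨ ΞTagged-∷ʳ n k (tagged f S) a t ⟩
    (if sameType (lastType (map proj₂ (tagged f S))) t then mapMaybe (_∷ʳ νCar n k t a) (ΞTagged n k (tagged f S))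
     else ΞStep n k (ΞTagged n k (tagged f S)) (t , a ∷ []))
      ≡⟨ cong₂ (λ l z → if sameType l t then mapMaybe (_∷ʳ νCar n k t a) z else ΞStep n k z (t , a ∷ []))
               (cong lastType (types-tagged f S)) (trans (sym (Ξ′-tagged f park)) Ξf) ⟩
    (if sameType (lastType (naplesTypes f S)) t then just (x ∷ʳ νCar n k t a) else ΞStep n k (just x) (t , a ∷ [])) ∎
    where
    open ≡-Reasoning
    t = naplesType a w

  Ξ′-∷ʳ-same : ∀ f {S a w x} → parkK k n f ≡ just S → naplesStep k n (occupied S) a ≡ just w → Ξ′ f ≡ just x →
    sameType (lastType (naplesTypes f S)) (naplesType a w) ≡ true → Ξ′ (f ∷ʳ a) ≡ just (x ∷ʳ νCar n k (naplesType a w) a)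
  Ξ′-∷ʳ-same f park nstep Ξf same = trans (Ξ′-∷ʳ f park nstep Ξf) (cong (λ b → if b then _ else _) same)

  Ξ′-∷ʳ-switch : ∀ f {S a w x} → parkK k n f ≡ just S → naplesStep k n (occupied S) a ≡ just w → Ξ′ f ≡ just x →
    sameType (lastType (naplesTypes f S)) (naplesType a w) ≡ false →
    Ξ′ (f ∷ʳ a) ≡ mapMaybe (_∷ʳ νCar n k (naplesType a w) a) (Φ n x)
  Ξ′-∷ʳ-switch f {a = a} {w} {x} park nstep Ξf same =
    trans (Ξ′-∷ʳ f park nstep Ξf)
      (trans (cong (λ b → if b then _ else _) same) (cong (λ z → mapMaybe (_++ z) (Φ n x)) (ν-single n k (naplesType a w) a)))

  record Extension {f x} (m : Matched f x) (a : ℕ) : Set where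
    field
      w : ℕ
      step : naplesStep k n (occupied (Matched.S m)) a ≡ just w
      x₀ : List ℕ
      branch : (sameType (Matched.lastT m) (naplesType a w) ≡ true × x₀ ≡ x)
             ⊎ (sameType (Matched.lastT m) (naplesType a w) ≡ false × Φ n x ≡ just x₀ × Φ n x₀ ≡ just x)
      Ξ≡ : Ξ′ (f ∷ʳ a) ≡ just (x₀ ∷ʳ νCar n k (naplesType a w) a)
      matched : Matched (f ∷ʳ a) (x₀ ∷ʳ νCar n k (naplesType a w) a)
      S≡ : Matched.S matched ≡ Matched.S m ∷ʳ w
      forward : naplesType a w ≡ false → k < a

  module _ {f x : List ℕ} {a : ℕ} (m : Matched f x) where
    open Matched m

    extend : InB (f ∷ʳ a) → Ξ′ f ≡ just x → Extension m a
    extend (_ , (_ , park) , contained) Ξf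
      with S₁ , w , park₁ , nstep₁ , refl ← run-∷ʳ⁻ (naplesStep k n) f a park
      with refl ← just-injective (trans (sym park₁) parkK≡)
      with contained′ ← ∉⇒Contained (ContainedPrefixes-last f a contained parkK≡)
      with sameType lastT (naplesType a w) in same
    ... | true with m′ , S≡ , forward ←
                 matched-∷ʳ parked nstep₁ (Occ-keep lastT (naplesType a w) σ S same occupancy) contained′ =
      record { w = w ; step = nstep₁ ; x₀ = x ; branch = inj₁ (same , refl)
             ; Ξ≡ = Ξ′-∷ʳ-same f parkK≡ nstep₁ Ξf same ; matched = m′ ; S≡ = S≡ ; forward = forward }
    ... | false with r@(reflectionFacts y Φx _ _ σ′ _ _ mirror Φy) ← reflection-facts n k x σ x-inLot parkC≡
                with m′ , S≡ , forward ← matched-∷ʳ (parked-reflected parked r) nstep₁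
                                           (Occ-switch lastT (naplesType a w) σ σ′ S same occupancy mirror) contained′ =
      record { w = w ; step = nstep₁ ; x₀ = y ; branch = inj₂ (same , Φx , Φy)
             ; Ξ≡ = trans (Ξ′-∷ʳ-switch f parkK≡ nstep₁ Ξf same) (cong (mapMaybe _) Φx)
             ; matched = m′ ; S≡ = S≡ ; forward = forward }

  matched-[] : Matched [] []
  matched-[] = record
    { parked = record { S = [] ; parkK≡ = refl ; σ = [] ; parkC≡ = refl ; x-inLot = [] ; length≡ = refl ; types≡ = refl }
    ; occupancy = λ v 1v vn → refl }

  Ξ′-matched : ∀ {f} → Reverse f → InB f → Σ (List ℕ) λ x → Ξ′ f ≡ just x × Matched f x
  Ξ′-matched [] _ = [] , refl , matched-[]
  Ξ′-matched (f ∶ rf ∶ʳ a) inB with x , Ξf , m ← Ξ′-matched rf (InB-init f a inB) =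
    _ , Extension.Ξ≡ e , Extension.matched e
    where e = extend m inB Ξf

  -- the types of the cars of f ∷ʳ a can be read off Ξ′ (f ∷ʳ a)
  extension-types : ∀ {f x a} {m : Matched f x} (e : Extension m a) →
    classicalTypes _ (Matched.σ (Extension.matched e)) ≡ naplesTypes f (Matched.S m) ∷ʳ naplesType a (Extension.w e)
  extension-types {f} {m = m} e = trans (sym (Matched.types≡ (Extension.matched e)))
    (trans (cong (naplesTypes _) (Extension.S≡ e)) (naplesTypes-∷ʳ f (Matched.parkK≡ m)))

  νCar-injective : ∀ t {a a′} → a ≤ n → a′ ≤ n → (t ≡ false → k < a) → (t ≡ false → k < a′) →
    νCar n k t a ≡ νCar n k t a′ → a ≡ a′
  νCar-injective true an an′ _ _ e = trans (sym (N∸-involutive n k an)) (trans (cong (suc n ∸_) e) (N∸-involutive n k an′))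
  νCar-injective false _ _ k<a k<a′ e =
    trans (sym (m∸n+n≡m (<⇒≤ (k<a refl)))) (trans (cong (_+ k) e) (m∸n+n≡m (<⇒≤ (k<a′ refl))))

  Ξ′≡[]⇒≡[] : ∀ {f} → Reverse f → InB f → Ξ′ f ≡ just [] → f ≡ []
  Ξ′≡[]⇒≡[] [] _ _ = refl
  Ξ′≡[]⇒≡[] r@(f ∶ _ ∶ʳ a) inB e with x , Ξf , m ← Ξ′-matched r inB with refl ← just-injective (trans (sym Ξf) e)
    with () ← trans (Matched.length≡ m) (trans (length-++ f) (+-comm (length f) 1))

  Ξ′-injective : ∀ {f f′ g} → Reverse f → Reverse f′ → InB f → InB f′ →
    Ξ′ f ≡ just g → Ξ′ f′ ≡ just g → f ≡ f′
  Ξ′-injective [] [] _ _ _ _ = refl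
  Ξ′-injective [] r′@(f′ ∶ _ ∶ʳ _) _ inB′ refl e′ = ⊥-elim (∷ʳ≢[] f′ (Ξ′≡[]⇒≡[] r′ inB′ e′))
  Ξ′-injective r@(f ∶ _ ∶ʳ _) [] inB _ e refl = ⊥-elim (∷ʳ≢[] f (Ξ′≡[]⇒≡[] r inB e))
  Ξ′-injective (h ∶ rh ∶ʳ a) (h′ ∶ rh′ ∶ʳ a′) inB inB′ e e′
    with x , Ξh , m ← Ξ′-matched rh (InB-init h a inB) | x′ , Ξh′ , m′ ← Ξ′-matched rh′ (InB-init h′ a′ inB′) =
    cong₂ _∷ʳ_ (Ξ′-injective rh rh′ (InB-init h a inB) (InB-init h′ a′ inB′) Ξh (trans Ξh′ (cong just (sym x≡x′)))) a≡a′
    where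
    module E = Extension (extend m inB Ξh)
    module E′ = Extension (extend m′ inB′ Ξh′)
    t t′ : Bool
    t = naplesType a E.w
    t′ = naplesType a′ E′.w
    g≡ : E.x₀ ∷ʳ νCar n k t a ≡ E′.x₀ ∷ʳ νCar n k t′ a′
    g≡ = just-injective (trans (sym E.Ξ≡) (trans e (trans (sym e′) E′.Ξ≡)))
    σ≡ : Matched.σ E.matched ≡ Matched.σ E′.matched
    σ≡ = just-injective (trans (sym (Matched.parkC≡ E.matched)) (trans (cong (parkC n) g≡) (Matched.parkC≡ E′.matched)))
    types≡ : naplesTypes h (Matched.S m) ∷ʳ t ≡ naplesTypes h′ (Matched.S m′) ∷ʳ t′
    types≡ = trans (sym (extension-types (extend m inB Ξh)))
               (trans (cong₂ classicalTypes g≡ σ≡) (extension-types (extend m′ inB′ Ξh′)))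
    t≡t′ : t ≡ t′
    t≡t′ = proj₂ (∷ʳ-injective _ _ types≡)
    same≡ : sameType (Matched.lastT m) t ≡ sameType (Matched.lastT m′) t′
    same≡ = cong₂ sameType (cong lastType (proj₁ (∷ʳ-injective _ _ types≡))) t≡t′
    x₀≡ : E.x₀ ≡ E′.x₀
    x₀≡ = proj₁ (∷ʳ-injective _ _ g≡)
    x≡x′ : x ≡ x′
    x≡x′ with E.branch | E′.branch
    ... | inj₁ (_ , e₁) | inj₁ (_ , e₂) = trans (sym e₁) (trans x₀≡ e₂)
    ... | inj₂ (_ , _ , i₁) | inj₂ (_ , _ , i₂) = just-injective (trans (sym i₁) (trans (cong (Φ n) x₀≡) i₂))
    ... | inj₁ (s₁ , _) | inj₂ (s₂ , _) = ⊥-elim (true≢false (trans (sym s₁) (trans same≡ s₂)))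
    ... | inj₂ (s₁ , _) | inj₁ (s₂ , _) = ⊥-elim (true≢false (trans (sym s₂) (trans (sym same≡) s₁)))
    a≡a′ : a ≡ a′
    a≡a′ = νCar-injective t (proj₁ (proj₂ (naplesStep-sound k n _ a E.step)))
                            (proj₁ (proj₂ (naplesStep-sound k n _ a′ E′.step)))
             E.forward (λ e → E′.forward (trans (sym t≡t′) e))
             (trans (proj₂ (∷ʳ-injective _ _ g≡)) (cong (λ z → νCar n k z a′) (sym t≡t′)))

  -- the branch of Ξ′ (f ∷ʳ a) is determined by the types, so x₀ is the expected prefix r
  branch-prefix : ∀ {L t t′ : Bool} {x x₀ r : List ℕ} → t ≡ t′ →
    ((sameType L t ≡ true × x₀ ≡ x) ⊎ (sameType L t ≡ false × Φ n x ≡ just x₀ × Φ n x₀ ≡ just x)) →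
    ((sameType L t′ ≡ true × x ≡ r) ⊎ (sameType L t′ ≡ false × Φ n x ≡ just r)) → x₀ ≡ r
  branch-prefix refl (inj₁ (_ , e₁)) (inj₁ (_ , e₂)) = trans e₁ e₂
  branch-prefix refl (inj₂ (_ , φ₁ , _)) (inj₂ (_ , φ₂)) = just-injective (trans (sym φ₁) φ₂)
  branch-prefix refl (inj₁ (s₁ , _)) (inj₂ (s₂ , _)) = ⊥-elim (true≢false (trans (sym s₁) s₂))
  branch-prefix refl (inj₂ (s₁ , _)) (inj₁ (s₂ , _)) = ⊥-elim (true≢false (trans (sym s₂) s₁))

  preimage-∷ʳ : ∀ {f x r σ q u} → InB f → Ξ′ f ≡ just x → (m : Matched f x) →
    classicalStep n (occupied σ) q ≡ just u → Occ (classicalType k q u) σ (Matched.S m) →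
    ((sameType (Matched.lastT m) (classicalType k q u) ≡ true × x ≡ r)
      ⊎ (sameType (Matched.lastT m) (classicalType k q u) ≡ false × Φ n x ≡ just r)) →
    Σ (List ℕ) λ f′ → InB f′ × Ξ′ f′ ≡ just (r ∷ʳ q)
  preimage-∷ʳ {f} {x} {r} {σ} {q} {u} (inLot , _ , contained) Ξf m cstep occ expected
    with a , w , nstep , ntype , νa≡q , contained-a ← classical⇒naples {σ} {Matched.S m} cstep occ
    with 1a , an , _ ← naplesStep-sound k n _ a nstep = f ∷ʳ a , inB , Ξ≡
    where
    open Matched m using (S; parkK≡)
    inB : InB (f ∷ʳ a)
    inB = ++⁺ inLot ((1a , an) ∷ []) , (S ∷ʳ w , run-∷ʳ⁺ (naplesStep k n) f parkK≡ nstep) ,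
          ContainedPrefixes-∷ʳ f a contained
            (λ ak S₁ park₁ → subst (λ S′ → ∃ λ v → 1 ≤ v × v ≤ a × v ∉ S′) (just-injective (trans (sym parkK≡) park₁))
                                    (Contained⇒∉ {S} contained-a ak))
    module E = Extension (extend m inB Ξf)
    t≡ : naplesType a E.w ≡ classicalType k q u
    t≡ = trans (cong (naplesType a) (just-injective (trans (sym E.step) nstep))) ntype
    Ξ≡ : Ξ′ (f ∷ʳ a) ≡ just (r ∷ʳ q)
    Ξ≡ = trans E.Ξ≡ (cong₂ (λ p z → just (p ∷ʳ z))
                       (branch-prefix {Matched.lastT m} t≡ E.branch expected)
                       (trans (cong (λ z → νCar n k z a) t≡) νa≡q))

  InB-[] : InB []
  InB-[] = [] , ([] , refl) , λ g a h e → ⊥-elim (∷-≢-[] g e)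
    where
    ∷-≢-[] : ∀ (g : List ℕ) {a h} → [] ≢ g ++ a ∷ h
    ∷-≢-[] [] ()
    ∷-≢-[] (_ ∷ _) ()

  -- by induction on the length, since a switch of types recurses on Φ of the prefix
  Ξ′-surjective : ∀ ℓ g → length g ≡ ℓ → InLot n g → (∃ λ σ → parkC n g ≡ just σ) →
    Σ (List ℕ) λ f → InB f × Ξ′ f ≡ just g
  Ξ′-surjective zero [] _ _ _ = [] , InB-[] , refl
  Ξ′-surjective (suc ℓ) g len inLot (_ , park) with reverseView g
  ... | [] with () ← len
  ... | r ∶ _ ∶ʳ q with σ , u , park-r , cstep , refl ← run-∷ʳ⁻ (classicalStep n) r q park
                   with len-r ← length-init r len
                   with sameType (lastType (classicalTypes r σ)) (classicalType k q u) in same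
  ... | true with f , inB , Ξf ← Ξ′-surjective ℓ r len-r (++⁻ˡ r inLot) (σ , park-r)
             with x , Ξf′ , m ← Ξ′-matched (reverseView f) inB
             with refl ← just-injective (trans (sym Ξf′) Ξf)
             with refl ← just-injective (trans (sym (Matched.parkC≡ m)) park-r) =
    preimage-∷ʳ inB Ξf m cstep (Occ-keep (Matched.lastT m) _ σ (Matched.S m) same′ (Matched.occupancy m)) (inj₁ (same′ , refl))
    where
    same′ : sameType (Matched.lastT m) (classicalType k q u) ≡ true
    same′ = trans (cong (λ l → sameType (lastType l) _) (Matched.types≡ m)) same
  ... | false
    with reflectionFacts y Φr inLot-y len-y σy park-y types-y _ Φy ← reflection-facts n k r σ (++⁻ˡ r inLot) park-r
    with f , inB , Ξf ← Ξ′-surjective ℓ y (trans len-y len-r) inLot-y (σy , park-y)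
    with x , Ξf′ , m ← Ξ′-matched (reverseView f) inB
    with refl ← just-injective (trans (sym Ξf′) Ξf)
    with refl ← just-injective (trans (sym (Matched.parkC≡ m)) park-y)
    with reflectionFacts r′ Φy′ _ _ σ′ park-r′ _ mirror _ ← reflection-facts n k y σy inLot-y park-y
    with refl ← just-injective (trans (sym Φy′) Φy)
    with refl ← just-injective (trans (sym park-r′) park-r) =
    preimage-∷ʳ inB Ξf m cstep (Occ-switch (Matched.lastT m) _ σy σ (Matched.S m) switch (Matched.occupancy m) mirror)
      (inj₂ (switch , Φy))
    where
    switch : sameType (Matched.lastT m) (classicalType k q u) ≡ false
    switch = trans (cong (λ l → sameType (lastType l) _) (trans (Matched.types≡ m) types-y)) same

theorem1 : (m n k : ℕ) → 1 ≤ m → m ≤ n → k < n →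
    ((f : List ℕ) → B m n k f → ∃ λ g → Ξ m n k f ≡ just g × PF m n g)
    × ((f f′ g : List ℕ) → B m n k f → B m n k f′ →
         Ξ m n k f ≡ just g → Ξ m n k f′ ≡ just g → f ≡ f′)
    × ((g : List ℕ) → PF m n g → ∃ λ f → B m n k f × Ξ m n k f ≡ just g)
theorem1 m n k _ _ _ = image , injective , surjective
  where
  open Main n k
  image : (f : List ℕ) → B m n k f → ∃ λ g → Ξ m n k f ≡ just g × PF m n g
  image f ((len , inLot , park) , c) with x , Ξf , matched ← Ξ′-matched (reverseView f) (inLot , park , c) =
    x , Ξf , trans (Matched.length≡ matched) len , Matched.x-inLot matched , (Matched.σ matched , Matched.parkC≡ matched)
  injective : (f f′ g : List ℕ) → B m n k f → B m n k f′ → Ξ m n k f ≡ just g → Ξ m n k f′ ≡ just g → f ≡ f′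
  injective f f′ g ((_ , inLot , park) , c) ((_ , inLot′ , park′) , c′) =
    Ξ′-injective (reverseView f) (reverseView f′) (inLot , park , c) (inLot′ , park′ , c′)
  surjective : (g : List ℕ) → PF m n g → ∃ λ f → B m n k f × Ξ m n k f ≡ just g
  surjective g (len , inLot , park) with f , inB@(inLot-f , park-f , c) , Ξf ← Ξ′-surjective m g len inLot park
    with x , Ξf′ , matched ← Ξ′-matched (reverseView f) inB with refl ← just-injective (trans (sym Ξf′) Ξf) =
    f , ((trans (sym (Matched.length≡ matched)) len , inLot-f , park-f) , c) , Ξf
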